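{- Let $k$ be an integer with $0\le k\le p-1$ ($p$ the relevant odd prime) and let $l,e$ be integers with $0<l\le e$. Then $D_{3^l,k}(1,x)$ is a permutation polynomial of $\mathbb{F}_{3^e}$ if and only if $k\neq 0$ and $\gcd\big(\frac{3^l-1}{2},\,3^e-1\big)=1$. Moreover, if $p>3$ is prime, then $D_{p^l,k}(1,x)$ is not a permutation polynomial of $\mathbb{F}_{p^e}$.
   Context: For a prime $p$, $q=p^e$, an integer $k$ with $0\le k\le p-1$, and an integer $n\ge1$, $D_{n,k}(1,x)=\sum_{i=0}^{\lfloor n/2\rfloor}\frac{n-ki}{n-i}\binom{n-i}{i}(-x)^i\in\mathbb{F}_q[x]$ (the coefficients are integers, reduced mod $p$). A permutation polynomial of $\mathbb{F}_q$ is a polynomial inducing a bijection of $\mathbb{F}_q$. -}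

module Defs where

open import Level using (Level; _⊔_)
open import Data.Nat as ℕ using (ℕ; zero; suc; _∸_)
open import Data.Nat.Combinatorics using (_C_)
open import Data.Integer as ℤ using (ℤ; +_; -[1+_]; _/ℕ_)
open import Data.Fin using (Fin)
open import Data.Product using (Σ; _×_)
open import Relation.Nullary using (¬_)
open import Relation.Binary.PropositionalEquality as ≡ using (_≡_)
open import Algebra.Bundles using (CommutativeRing)
open import Function.Bundles using (Inverse)
open import Function.Definitions using (Bijective)

record Field (c ℓ : Level) : Set (Level.suc (c ⊔ ℓ)) where
  field
    commRing : CommutativeRing c ℓ
  open CommutativeRing commRing public
  field
    1≉0     : ¬ (1# ≈ 0#)
    inverse : ∀ x → ¬ (x ≈ 0#) → Σ Carrier (λ y → (x * y) ≈ 1#)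

record FiniteField (c ℓ : Level) (q : ℕ) : Set (Level.suc (c ⊔ ℓ)) where
  field
    fld : Field c ℓ
  open Field fld public
  field
    enum : Inverse (≡.setoid (Fin q)) setoid

module _ {c ℓ : Level} {q : ℕ} (F : FiniteField c ℓ q) where
  open FiniteField F

  natF : ℕ → Carrier
  natF zero    = 0#
  natF (suc n) = 1# + natF n

  intF : ℤ → Carrier
  intF (+ n)     = natF n
  intF -[1+ n ]  = - natF (suc n)

  _^F_ : Carrier → ℕ → Carrier
  x ^F zero    = 1#
  x ^F (suc m) = x * (x ^F m)

  sumF : ℕ → (ℕ → Carrier) → Carrier
  sumF zero    f = f 0
  sumF (suc m) f = sumF m f + f (suc m)

  IsPermutation : (Carrier → Carrier) → Set (c ⊔ ℓ)
  IsPermutation f = Bijective _≈_ _≈_ f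

-- Integer coefficient  (n - k i)/(n - i) · binom(n - i, i)
-- (exact division in ℤ; n - i ≠ 0 whenever 0 ≤ i ≤ ⌊n/2⌋ and n ≥ 1;
--  the degenerate case n - i = 0 never occurs in D below for n ≥ 1).
dicksonCoeff : ℕ → ℕ → ℕ → ℤ
dicksonCoeff n k i with n ∸ i
... | zero  = + 0
... | suc m = (((+ n) ℤ.- ((+ k) ℤ.* (+ i))) ℤ.* (+ ((n ∸ i) C i))) /ℕ (suc m)

D : {c ℓ : Level} {q : ℕ} (F : FiniteField c ℓ q) → ℕ → ℕ → FiniteField.Carrier F → FiniteField.Carrier F
D F n k x = sumF F (n ℕ./ 2) (λ i → intF F (dicksonCoeff n k i) * (_^F_ F (- x) i))
  where open FiniteField F

module Submission where

-- Write n = p^l = 2M + 1.  Splitting each coefficient (n - ki)/(n - i) · C(n-i, i) by absorption gives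
-- D_{n,k}(1, -y) = E_n(y) + (1 - k) y E_{n-2}(y) with E_N(y) = Σᵢ C(N-i, i) yⁱ, which obeys the Fibonacci
-- recursion E_{N+2} = E_{N+1} + y E_N.  Binet's formula expresses E_N through the powers of
-- α = (1 + √w)/2, w = 1 + 4y, in F[√w], and in characteristic p the Frobenius map gives
-- α^n = (1 + w^M √w)/2.  Hence D_{n,k}(1, x) = 1 + k ((1 - 4x)^M - 1)/2, a permutation of F_q exactly when
-- k ≠ 0 in F and x ↦ x^M is injective, that is gcd(M, q - 1) = 1.  For p = 3 this is the stated criterion;
-- for p > 3, 4^M = 2^(n-1) = 1 = 1^M although 4 ≠ 1, so x ↦ x^M is never injective.

open import Defs
open import Level using (Level)
open import Algebra.Bundles using (CommutativeRing)
import Data.Nat as ℕ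
open import Data.Nat using (ℕ)
open import Data.Nat.Primality using (Prime)
open import Relation.Binary.PropositionalEquality using (_≡_)

module Binomial where

  open import Data.Nat
  open import Data.Nat.Properties
  open import Data.Nat.Combinatorics using (_C_; nCk+nC[k+1]≡[n+1]C[k+1])
  open import Data.Nat.Divisibility using (_∣_; divides; ∣⇒≤)
  open import Data.Nat.Primality using (Prime; euclidsLemma)
  open import Data.Nat.Tactic.RingSolver using (solve-∀)
  open import Data.Sum using (inj₁; inj₂)
  open import Relation.Nullary using (contradiction)
  open import Relation.Binary.PropositionalEquality
  open ≡-Reasoning

  -- Pascal's rule as the defining recursion, so that binomial coefficients compute.
  choose : ℕ → ℕ → ℕ
  choose _       zero    = 1
  choose zero    (suc k) = 0
  choose (suc n) (suc k) = choose n k + choose n (suc k)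

  choose≡C : ∀ n k → choose n k ≡ n C k
  choose≡C n       zero    = refl
  choose≡C zero    (suc k) = refl
  choose≡C (suc n) (suc k) =
    trans (cong₂ _+_ (choose≡C n k) (choose≡C n (suc k))) (nCk+nC[k+1]≡[n+1]C[k+1] n k)

  k>n⇒choose≡0 : ∀ {n k} → n < k → choose n k ≡ 0
  k>n⇒choose≡0 {zero}  {suc k} _         = refl
  k>n⇒choose≡0 {suc n} {suc k} (s≤s n<k) =
    cong₂ _+_ (k>n⇒choose≡0 n<k) (k>n⇒choose≡0 (m<n⇒m<1+n n<k))

  choose-1 : ∀ n → choose n 1 ≡ n
  choose-1 zero    = refl
  choose-1 (suc n) = cong suc (choose-1 n)

  [1+k]*[1+n]C[1+k]≡[1+n]*nCk : ∀ n k → suc k * choose (suc n) (suc k) ≡ suc n * choose n k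
  [1+k]*[1+n]C[1+k]≡[1+n]*nCk n zero =
    trans (+-identityʳ _) (trans (cong suc (choose-1 n)) (sym (*-identityʳ (suc n))))
  [1+k]*[1+n]C[1+k]≡[1+n]*nCk zero (suc k) = *-zeroʳ (suc (suc k))
  [1+k]*[1+n]C[1+k]≡[1+n]*nCk (suc n) (suc k) = begin
    suc (suc k) * (a + b)                       ≡⟨ distrib k a b ⟩
    (suc k * a + a) + suc (suc k) * b           ≡⟨ cong₂ (λ u v → (u + a) + v)
                                                     ([1+k]*[1+n]C[1+k]≡[1+n]*nCk n k)
                                                     ([1+k]*[1+n]C[1+k]≡[1+n]*nCk n (suc k)) ⟩
    (suc n * choose n k + a) + suc n * choose n (suc k)  ≡⟨ regroup n (choose n k) a (choose n (suc k)) ⟩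
    suc n * (choose n k + choose n (suc k)) + a ≡⟨ +-comm (suc n * a) a ⟩
    suc (suc n) * a                             ∎
    where
    a = choose (suc n) (suc k)
    b = choose (suc n) (suc (suc k))
    distrib : ∀ k a b → suc (suc k) * (a + b) ≡ (suc k * a + a) + suc (suc k) * b
    distrib = solve-∀
    regroup : ∀ n a b c → (suc n * a + b) + suc n * c ≡ suc n * (a + c) + b
    regroup = solve-∀

  -- From k · C(p,k) = p · C(p-1,k-1) and p ∤ k.
  p∣pCk : ∀ {p k} → Prime p → 0 < k → k < p → p ∣ p C k
  p∣pCk {suc p} {suc k} p-prime _ k<p
    with euclidsLemma (suc k) (choose (suc p) (suc k)) p-prime
           (divides (choose p k) (trans ([1+k]*[1+n]C[1+k]≡[1+n]*nCk p k) (*-comm (suc p) (choose p k))))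
  ... | inj₁ p∣k     = contradiction (∣⇒≤ p∣k) (<⇒≱ k<p)
  ... | inj₂ p∣pCk′ = subst (suc p ∣_) (choose≡C (suc p) (suc k)) p∣pCk′

module Arithmetic where

  open import Data.Nat
  open import Data.Nat.Properties
  open import Data.Nat.DivMod using (m*n/n≡m; m*n%n≡0; m%n<n; m≡m%n+[m/n]*n; +-distrib-/)
  open import Data.Nat.Divisibility using (divides; ∣-refl)
  open import Data.Nat.Primality using (Prime)
  open import Data.Nat.Coprimality using (prime⇒coprime)
  open import Data.Nat.Tactic.RingSolver using (solve-∀)
  open import Data.Product using (∃; _,_)
  open import Relation.Nullary using (contradiction)
  open import Relation.Binary.PropositionalEquality

  private
    m+m≡m*2 : ∀ m → m + m ≡ m * 2
    m+m≡m*2 = solve-∀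

  [m+m]/2≡m : ∀ m → (m + m) / 2 ≡ m
  [m+m]/2≡m m = trans (cong (_/ 2) (m+m≡m*2 m)) (m*n/n≡m m 2)

  [1+m+m]/2≡m : ∀ m → suc (m + m) / 2 ≡ m
  [1+m+m]/2≡m m = begin
    suc (m + m) / 2    ≡⟨ cong (λ z → suc z / 2) (m+m≡m*2 m) ⟩
    (1 + m * 2) / 2    ≡⟨ +-distrib-/ 1 (m * 2) (subst (λ z → 1 + z < 2) (sym (m*n%n≡0 m 2)) ≤-refl) ⟩
    0 + m * 2 / 2      ≡⟨ m*n/n≡m m 2 ⟩
    m                  ∎
    where open ≡-Reasoning

  N∸i<i : ∀ {N M i} → N ≤ M + suc M → M < i → N ∸ i < i
  N∸i<i {N} {M} {i} N≤2M+1 M<i = ≤-<-trans (begin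
    N ∸ i             ≤⟨ ∸-monoʳ-≤ N M<i ⟩
    N ∸ suc M         ≤⟨ ∸-monoˡ-≤ (suc M) N≤2M+1 ⟩
    M + suc M ∸ suc M ≡⟨ m+n∸n≡m M (suc M) ⟩
    M                 ∎) M<i
    where open ≤-Reasoning

  odd-prime : ∀ {p} → Prime p → 2 < p → ∃ λ a → p ≡ suc (a + a)
  odd-prime {p} p-prime 2<p with p % 2 | m%n<n p 2 | m≡m%n+[m/n]*n p 2
  ... | 0 | _ | p≡[p/2]*2 =
    contradiction (prime⇒coprime p-prime 2<p (divides (p / 2) p≡[p/2]*2 , ∣-refl)) λ ()
  ... | 1 | _ | p≡1+[p/2]*2 = p / 2 , trans p≡1+[p/2]*2 (cong suc (sym (m+m≡m*2 (p / 2))))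
  ... | 2+ _ | s≤s (s≤s ()) | _

  odd^n-odd : ∀ a n → ∃ λ t → suc (a + a) ^ n ≡ suc (t + t)
  odd^n-odd a zero    = 0 , refl
  odd^n-odd a (suc n) with odd^n-odd a n
  ... | t , eq = t + a * suc (t + t) , trans (cong (suc (a + a) *_) eq) (lemma a t)
    where
    lemma : ∀ a t → suc (a + a) * suc (t + t) ≡ suc ((t + a * suc (t + t)) + (t + a * suc (t + t)))
    lemma = solve-∀

  odd-prime^n : ∀ {p n} → Prime p → 2 < p → 0 < n → ∃ λ m → p ^ n ≡ 3 + (m + m)
  odd-prime^n {p} {suc n} p-prime 2<p _ with odd-prime p-prime 2<p
  ... | a , refl with odd^n-odd a (suc n)
  ... | zero , eq = contradiction (m≤n⇒m≤1+n (subst (suc (a + a) ≤_) eq p≤p^[1+n])) (<⇒≱ 2<p)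
    where
    p≤p^[1+n] : suc (a + a) ≤ suc (a + a) ^ suc n
    p≤p^[1+n] = m≤m*n (suc (a + a)) (suc (a + a) ^ n) {{>-nonZero (m^n>0 (suc (a + a)) n)}}
  ... | suc t , eq = t , trans eq (cong (λ z → suc (suc z)) (+-suc t t))

module DicksonCoefficients where

  open Binomial
  open import Data.Nat as ℕ using (ℕ; zero; suc; _∸_)
  open import Data.Nat.Properties using (m+n∸n≡m)
  import Data.Nat.DivMod as ℕ
  open import Data.Nat.Combinatorics using (_C_)
  open import Data.Integer using (+_; -[1+_]; _+_; _-_; _*_; _/ℕ_)
  open import Data.Integer.Properties using (pos-*; pos-+)
  open import Data.Integer.Tactic.RingSolver using (solve-∀)
  open import Relation.Binary.PropositionalEquality
  open ≡-Reasoning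

  i*n/ℕn≡i : ∀ i n → (i * + suc n) /ℕ suc n ≡ i
  i*n/ℕn≡i (+ zero)  n = refl
  i*n/ℕn≡i (+ suc t) n = cong +_ (ℕ.m*n/n≡m (suc t) (suc n))
  i*n/ℕn≡i -[1+ t ]  n with suc (n ℕ.+ t ℕ.* suc n) ℕ.% suc n | ℕ.m*n%n≡0 (suc t) (suc n)
  ... | .zero | refl = cong (λ v → - (+ v)) (ℕ.m*n/n≡m (suc t) (suc n))
    where open import Data.Integer using (-_)

  dicksonCoeff-unfold : ∀ n k i {m} → n ∸ i ≡ suc m →
    dicksonCoeff n k i ≡ ((+ n - + k * + i) * + (suc m C i)) /ℕ suc m
  dicksonCoeff-unfold n k i eq with n ∸ i in n∸i≡
  ... | suc m with refl ← eq = cong (λ z → ((+ n - + k * + i) * + (z C i)) /ℕ suc m) n∸i≡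

  dicksonCoeff-zero : ∀ n k → dicksonCoeff (suc n) k 0 ≡ + 1
  dicksonCoeff-zero n k = begin
    dicksonCoeff (suc n) k 0                     ≡⟨ dicksonCoeff-unfold (suc n) k 0 refl ⟩
    ((+ suc n - + k * + 0) * + 1) /ℕ suc n       ≡⟨ cong (_/ℕ suc n) (lemma (+ suc n) (+ k)) ⟩
    (+ 1 * + suc n) /ℕ suc n                     ≡⟨ i*n/ℕn≡i (+ 1) n ⟩
    + 1                                          ∎
    where
    lemma : ∀ a b → (a - b * + 0) * + 1 ≡ + 1 * a
    lemma = solve-∀

  -- Splitting off i/(n-i) · C(n-i,i) = C(n-i-1,i-1) by absorption.
  dicksonCoeff-suc : ∀ N j k → dicksonCoeff (suc N ℕ.+ suc j) k (suc j)
                             ≡ + choose (suc N) (suc j) + (+ 1 - + k) * + choose N j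
  dicksonCoeff-suc N j k = begin
    dicksonCoeff n k (suc j)
      ≡⟨ dicksonCoeff-unfold n k (suc j) (m+n∸n≡m (suc N) (suc j)) ⟩
    ((+ n - + k * + suc j) * + (suc N C (suc j))) /ℕ suc N
      ≡⟨ cong (λ z → ((+ n - + k * + suc j) * + z) /ℕ suc N) (sym (choose≡C (suc N) (suc j))) ⟩
    ((+ n - + k * + suc j) * + A) /ℕ suc N
      ≡⟨ cong (_/ℕ suc N) numerator ⟩
    ((+ A + (+ 1 - + k) * + B) * + suc N) /ℕ suc N
      ≡⟨ i*n/ℕn≡i _ N ⟩
    + A + (+ 1 - + k) * + B ∎
    where
    n = suc N ℕ.+ suc j
    A = choose (suc N) (suc j)
    B = choose N j
    absorption : + suc j * + A ≡ + suc N * + B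
    absorption = trans (sym (pos-* (suc j) A))
                       (trans (cong +_ ([1+k]*[1+n]C[1+k]≡[1+n]*nCk N j)) (pos-* (suc N) B))
    expand : ∀ N J k A → (N + J - k * J) * A ≡ N * A + (+ 1 - k) * (J * A)
    expand = solve-∀
    collect : ∀ N k A B → N * A + (+ 1 - k) * (N * B) ≡ (A + (+ 1 - k) * B) * N
    collect = solve-∀
    numerator : (+ n - + k * + suc j) * + A ≡ (+ A + (+ 1 - + k) * + B) * + suc N
    numerator = begin
      (+ n - + k * + suc j) * + A
        ≡⟨ cong (λ z → (z - + k * + suc j) * + A) (pos-+ (suc N) (suc j)) ⟩
      (+ suc N + + suc j - + k * + suc j) * + A
        ≡⟨ expand (+ suc N) (+ suc j) (+ k) (+ A) ⟩
      + suc N * + A + (+ 1 - + k) * (+ suc j * + A)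
        ≡⟨ cong (λ z → + suc N * + A + (+ 1 - + k) * z) absorption ⟩
      + suc N * + A + (+ 1 - + k) * (+ suc N * + B)
        ≡⟨ collect (+ suc N) (+ k) (+ A) (+ B) ⟩
      (+ A + (+ 1 - + k) * + B) * + suc N ∎

module RingProperties {c ℓ : Level} (R : CommutativeRing c ℓ) where

  open CommutativeRing R
  open import Algebra.Properties.Ring ring using (-‿involutive; -‿+-comm; -1*x≈-x; -0#≈0#)
  open import Algebra.Properties.Semiring.Mult semiring using (_×_; ×-homo-+; ×1-homo-*)
  open import Algebra.Properties.Semiring.Exp semiring using (_^_)
  open import Algebra.Properties.CommutativeSemigroup *-commutativeSemigroup using (interchange)
  open import Algebra.Solver.Ring.AlmostCommutativeRing
    using (fromCommutativeRing; _-Raw-AlmostCommutative⟶_)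
  open import Data.Nat as ℕ using (ℕ; zero; suc)
  open import Data.Integer as ℤ using (ℤ; +_; -[1+_]; _⊖_)
  import Data.Integer.Properties as ℤ
  open import Data.Sign as Sign using (Sign)
  open import Data.Maybe using (Maybe; map)
  open import Relation.Nullary.Decidable using (dec⇒maybe)
  open import Relation.Binary.PropositionalEquality as ≡ using (_≡_)
  open import Relation.Binary.Reasoning.Setoid setoid

  1^n≈1 : ∀ n → 1# ^ n ≈ 1#
  1^n≈1 zero    = refl
  1^n≈1 (suc n) = trans (*-identityˡ _) (1^n≈1 n)

  fromℤ : ℤ → Carrier
  fromℤ (+ n)    = n × 1#
  fromℤ -[1+ n ] = - (suc n × 1#)

  private
    [1+a]-[1+b]≈a-b : ∀ a b → (1# + a) - (1# + b) ≈ a - b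
    [1+a]-[1+b]≈a-b a b = begin
      (1# + a) + - (1# + b)    ≈⟨ +-congˡ (-‿+-comm 1# b) ⟨
      (1# + a) + (- 1# + - b)  ≈⟨ +-assoc 1# a _ ⟩
      1# + (a + (- 1# + - b))  ≈⟨ +-congˡ (+-assoc a _ _) ⟨
      1# + ((a + - 1#) + - b)  ≈⟨ +-congˡ (+-congʳ (+-comm a _)) ⟩
      1# + ((- 1# + a) + - b)  ≈⟨ +-congˡ (+-assoc _ a _) ⟩
      1# + (- 1# + (a + - b))  ≈⟨ +-assoc 1# _ _ ⟨
      (1# + - 1#) + (a + - b)  ≈⟨ +-congʳ (-‿inverseʳ 1#) ⟩
      0# + (a + - b)           ≈⟨ +-identityˡ _ ⟩
      a - b                    ∎

    fromℤ-⊖ : ∀ m n → fromℤ (m ⊖ n) ≈ m × 1# - n × 1#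
    fromℤ-⊖ m       zero    rewrite ℤ.⊖-≥ (ℕ.z≤n {m}) =
      sym (trans (+-congˡ -0#≈0#) (+-identityʳ _))
    fromℤ-⊖ zero    (suc n) rewrite ℤ.⊖-< (ℕ.s≤s (ℕ.z≤n {n})) = sym (+-identityˡ _)
    fromℤ-⊖ (suc m) (suc n) rewrite ℤ.[1+m]⊖[1+n]≡m⊖n m n =
      trans (fromℤ-⊖ m n) (sym ([1+a]-[1+b]≈a-b _ _))

    sign : Sign → Carrier
    sign Sign.+ = 1#
    sign Sign.- = - 1#

    sign-homo-* : ∀ s t → sign (s Sign.* t) ≈ sign s * sign t
    sign-homo-* Sign.- Sign.- = sym (trans (-1*x≈-x _) (-‿involutive _))
    sign-homo-* Sign.- Sign.+ = sym (*-identityʳ _)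
    sign-homo-* Sign.+ Sign.- = sym (*-identityˡ _)
    sign-homo-* Sign.+ Sign.+ = sym (*-identityˡ _)

    fromℤ-◃ : ∀ s n → fromℤ (s ℤ.◃ n) ≈ sign s * (n × 1#)
    fromℤ-◃ Sign.- zero    = sym (zeroʳ _)
    fromℤ-◃ Sign.+ zero    = sym (zeroʳ _)
    fromℤ-◃ Sign.+ (suc n) = sym (*-identityˡ _)
    fromℤ-◃ Sign.- (suc n) = sym (-1*x≈-x _)

    fromℤ≈sign*∣∣ : ∀ i → fromℤ i ≈ sign (ℤ.sign i) * (ℤ.∣ i ∣ × 1#)
    fromℤ≈sign*∣∣ (+ n)    = sym (*-identityˡ _)
    fromℤ≈sign*∣∣ -[1+ n ] = sym (-1*x≈-x _)

  fromℤ-‿homo : ∀ i → fromℤ (ℤ.- i) ≈ - fromℤ i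
  fromℤ-‿homo (+ zero)  = sym -0#≈0#
  fromℤ-‿homo (+ suc n) = refl
  fromℤ-‿homo -[1+ n ]  = sym (-‿involutive _)

  fromℤ-+-homo : ∀ i j → fromℤ (i ℤ.+ j) ≈ fromℤ i + fromℤ j
  fromℤ-+-homo -[1+ m ] -[1+ n ] = begin
    - (1# + (suc m ℕ.+ n) × 1#)            ≈⟨ -‿cong (+-congˡ (×-homo-+ 1# (suc m) n)) ⟩
    - (1# + (suc m × 1# + n × 1#))         ≈⟨ -‿cong (+-assoc 1# _ _) ⟨
    - ((1# + suc m × 1#) + n × 1#)         ≈⟨ -‿cong (+-congʳ (+-comm 1# _)) ⟩
    - ((suc m × 1# + 1#) + n × 1#)         ≈⟨ -‿cong (+-assoc _ 1# _) ⟩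
    - (suc m × 1# + suc n × 1#)            ≈⟨ -‿+-comm _ _ ⟨
    - (suc m × 1#) + - (suc n × 1#)        ∎
  fromℤ-+-homo -[1+ m ] (+ n)    = trans (fromℤ-⊖ n (suc m)) (+-comm _ _)
  fromℤ-+-homo (+ m)    -[1+ n ] = fromℤ-⊖ m (suc n)
  fromℤ-+-homo (+ m)    (+ n)    = ×-homo-+ 1# m n

  fromℤ-*-homo : ∀ i j → fromℤ (i ℤ.* j) ≈ fromℤ i * fromℤ j
  fromℤ-*-homo i j = begin
    fromℤ (i ℤ.* j)
      ≈⟨ fromℤ-◃ (ℤ.sign i Sign.* ℤ.sign j) (ℤ.∣ i ∣ ℕ.* ℤ.∣ j ∣) ⟩
    sign (ℤ.sign i Sign.* ℤ.sign j) * ((ℤ.∣ i ∣ ℕ.* ℤ.∣ j ∣) × 1#)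
      ≈⟨ *-cong (sign-homo-* (ℤ.sign i) (ℤ.sign j)) (×1-homo-* ℤ.∣ i ∣ ℤ.∣ j ∣) ⟩
    (sign (ℤ.sign i) * sign (ℤ.sign j)) * ((ℤ.∣ i ∣ × 1#) * (ℤ.∣ j ∣ × 1#))
      ≈⟨ interchange _ _ _ _ ⟩
    (sign (ℤ.sign i) * (ℤ.∣ i ∣ × 1#)) * (sign (ℤ.sign j) * (ℤ.∣ j ∣ × 1#))
      ≈⟨ *-cong (fromℤ≈sign*∣∣ i) (fromℤ≈sign*∣∣ j) ⟨
    fromℤ i * fromℤ j ∎

  fromℤ-morphism : CommutativeRing.rawRing ℤ.+-*-commutativeRing
                     -Raw-AlmostCommutative⟶ fromCommutativeRing R
  fromℤ-morphism = record
    { ⟦_⟧ = fromℤ ; +-homo = fromℤ-+-homo ; *-homo = fromℤ-*-homo ; -‿homo = fromℤ-‿homo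
    ; 0-homo = refl ; 1-homo = +-identityʳ 1# }

  fromℤ-≟ : ∀ i j → Maybe (fromℤ i ≈ fromℤ j)
  fromℤ-≟ i j = map (λ i≡j → reflexive (≡.cong fromℤ i≡j)) (dec⇒maybe (i ℤ.≟ j))

  open import Algebra.Solver.Ring (CommutativeRing.rawRing ℤ.+-*-commutativeRing)
    (fromCommutativeRing R) fromℤ-morphism fromℤ-≟ public
    using (solve; _:=_; _:+_; _:*_; _:-_; con)

module Frobenius {c ℓ : Level} (R : CommutativeRing c ℓ) where

  open CommutativeRing R
  open import Algebra.Properties.Semiring.Mult semiring using (_×_; ×-congʳ; ×-assoc-*; ×-assocˡ)
  open import Algebra.Properties.Semiring.Exp semiring using (_^_; ^-congˡ; ^-assocʳ)
  open import Algebra.Properties.CommutativeSemiring.Binomial commutativeSemiring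
    using (theorem; binomialTerm)
  open import Algebra.Properties.Monoid.Sum +-monoid
    using (sum; sum-init-last; sum-cong-≋; sum-replicate-zero)
  open import Data.Nat as ℕ using (ℕ; zero; suc; z≤n; s≤s)
  import Data.Nat.Properties as ℕ
  open import Data.Nat.Combinatorics using (_C_; nCn≡1)
  open import Data.Nat.Divisibility using (divides)
  open import Data.Nat.Primality using (Prime; prime⇒nonZero)
  open import Relation.Nullary using (contradiction)
  open import Data.Fin as Fin using (Fin; toℕ; fromℕ; inject₁)
  open import Data.Fin.Properties using (toℕ-inject₁; toℕ<n; toℕ-fromℕ)
  open import Relation.Binary.PropositionalEquality as ≡ using (_≡_)
  open import Relation.Binary.Reasoning.Setoid setoid
  open Binomial using (p∣pCk)
  open RingProperties R using (1^n≈1)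

  ×0≈0 : ∀ n → n × 0# ≈ 0#
  ×0≈0 zero    = refl
  ×0≈0 (suc n) = trans (+-identityˡ _) (×0≈0 n)

  module _ {p : ℕ} (p-prime : Prime p) (p×1≈0 : p × 1# ≈ 0#) where

    p×x≈0 : ∀ x → p × x ≈ 0#
    p×x≈0 x = begin
      p × x          ≈⟨ ×-congʳ p (*-identityˡ x) ⟨
      p × (1# * x)   ≈⟨ ×-assoc-* p 1# x ⟨
      (p × 1#) * x   ≈⟨ *-congʳ p×1≈0 ⟩
      0# * x         ≈⟨ zeroˡ x ⟩
      0#             ∎

    pCk×x≈0 : ∀ {k} x → 0 ℕ.< k → k ℕ.< p → (p C k) × x ≈ 0#
    pCk×x≈0 {k} x 0<k k<p with p∣pCk p-prime 0<k k<p
    ... | divides r pCk≡r*p = begin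
      (p C k) × x    ≡⟨ ≡.cong (_× x) pCk≡r*p ⟩
      (r ℕ.* p) × x  ≈⟨ ×-assocˡ x r p ⟨
      r × (p × x)    ≈⟨ ×-congʳ r (p×x≈0 x) ⟩
      r × 0#         ≈⟨ ×0≈0 r ⟩
      0#             ∎

  -- Only the outer terms of the binomial expansion survive, as p ∣ C(p, k) for 0 < k < p.
  frobenius : ∀ {p} → Prime p → p × 1# ≈ 0# → ∀ x y → (x + y) ^ p ≈ x ^ p + y ^ p
  frobenius {zero}  p-prime _ _ _ = contradiction ≡.refl (ℕ.≢-nonZero⁻¹ 0 {{prime⇒nonZero p-prime}})
  frobenius {suc n} p-prime p×1≈0 x y = begin
    (x + y) ^ suc n
      ≈⟨ theorem (suc n) x y ⟩
    T Fin.zero + sum (λ i → T (Fin.suc i))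
      ≈⟨ +-congˡ (sum-init-last (λ i → T (Fin.suc i))) ⟩
    T Fin.zero + (sum (λ i → T (Fin.suc (inject₁ i))) + T (Fin.suc (fromℕ n)))
      ≈⟨ +-cong first (+-cong middle last) ⟩
    y ^ suc n + (0# + x ^ suc n)
      ≈⟨ +-congˡ (+-identityˡ _) ⟩
    y ^ suc n + x ^ suc n
      ≈⟨ +-comm _ _ ⟩
    x ^ suc n + y ^ suc n ∎
    where
    T = binomialTerm x y (suc n)
    first : T Fin.zero ≈ y ^ suc n
    first = trans (+-identityʳ _) (*-identityˡ _)
    middle : sum (λ i → T (Fin.suc (inject₁ i))) ≈ 0#
    middle = trans (sum-cong-≋ {n} (λ i → pCk×x≈0 p-prime p×1≈0 _ (s≤s z≤n) (s≤s (i<n i))))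
                   (sum-replicate-zero n)
      where
      i<n : ∀ (i : Fin n) → toℕ (inject₁ i) ℕ.< n
      i<n i = ≡.subst (ℕ._< n) (≡.sym (toℕ-inject₁ i)) (toℕ<n i)
    last : T (Fin.suc (fromℕ n)) ≈ x ^ suc n
    last rewrite toℕ-fromℕ n | nCn≡1 (suc n) | ℕ.n∸n≡0 n =
      trans (+-identityʳ _) (*-identityʳ _)

  frobenius-^ : ∀ {p} → Prime p → p × 1# ≈ 0# →
                ∀ n x y → (x + y) ^ (p ℕ.^ n) ≈ x ^ (p ℕ.^ n) + y ^ (p ℕ.^ n)
  frobenius-^ _ _ zero x y =
    trans (*-identityʳ _) (sym (+-cong (*-identityʳ x) (*-identityʳ y)))
  frobenius-^ {p} p-prime p×1≈0 (suc n) x y = begin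
    (x + y) ^ (p ℕ.* p ℕ.^ n)                 ≈⟨ ^-assocʳ (x + y) p (p ℕ.^ n) ⟨
    ((x + y) ^ p) ^ (p ℕ.^ n)                 ≈⟨ ^-congˡ (p ℕ.^ n) (frobenius p-prime p×1≈0 x y) ⟩
    (x ^ p + y ^ p) ^ (p ℕ.^ n)               ≈⟨ frobenius-^ p-prime p×1≈0 n (x ^ p) (y ^ p) ⟩
    (x ^ p) ^ (p ℕ.^ n) + (y ^ p) ^ (p ℕ.^ n) ≈⟨ +-cong (^-assocʳ x p _) (^-assocʳ y p _) ⟩
    x ^ (p ℕ.* p ℕ.^ n) + y ^ (p ℕ.* p ℕ.^ n) ∎

  [k×1]^p^n≈k×1 : ∀ {p} → Prime p → p × 1# ≈ 0# → ∀ n k → (k × 1#) ^ (p ℕ.^ n) ≈ k × 1#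
  [k×1]^p^n≈k×1 {p} p-prime p×1≈0 n zero with p ℕ.^ n | ℕ.m^n>0 p {{prime⇒nonZero p-prime}} n
  ... | suc _ | _ = zeroˡ _
  [k×1]^p^n≈k×1 {p} p-prime p×1≈0 n (suc k) = begin
    (1# + k × 1#) ^ (p ℕ.^ n)                ≈⟨ frobenius-^ p-prime p×1≈0 n 1# (k × 1#) ⟩
    1# ^ (p ℕ.^ n) + (k × 1#) ^ (p ℕ.^ n)    ≈⟨ +-cong (1^n≈1 (p ℕ.^ n)) ([k×1]^p^n≈k×1 p-prime p×1≈0 n k) ⟩
    1# + k × 1#                              ∎

module QuadraticExtension {c ℓ : Level} (R : CommutativeRing c ℓ) (w : CommutativeRing.Carrier R) where

  open CommutativeRing R
  open RingProperties R
  open import Data.Product using (_×_; _,_)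
  open import Algebra.Structures using (IsCommutativeRing)

  -- (a , b) stands for a + b √w.
  Carrier′ : Set c
  Carrier′ = Carrier × Carrier

  infix  4 _≈′_
  infixl 6 _+′_
  infixl 7 _*′_

  _≈′_ : Carrier′ → Carrier′ → Set ℓ
  (a , b) ≈′ (c , d) = a ≈ c × b ≈ d

  _+′_ _*′_ : Carrier′ → Carrier′ → Carrier′
  (a , b) +′ (c , d) = a + c , b + d
  (a , b) *′ (c , d) = a * c + w * (b * d) , a * d + b * c

  -′_ : Carrier′ → Carrier′
  -′ (a , b) = - a , - b

  0′ 1′ : Carrier′
  0′ = 0# , 0#
  1′ = 1# , 0#

  isCommutativeRing′ : IsCommutativeRing _≈′_ _+′_ _*′_ -′_ 0′ 1′
  isCommutativeRing′ = record
    { isRing = record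
      { +-isAbelianGroup = record
        { isGroup = record
          { isMonoid = record
            { isSemigroup = record
              { isMagma = record
                { isEquivalence = record
                  { refl  = refl , refl
                  ; sym   = λ (p , q) → sym p , sym q
                  ; trans = λ (p , q) (p′ , q′) → trans p p′ , trans q q′ }
                ; ∙-cong = λ (p , q) (p′ , q′) → +-cong p p′ , +-cong q q′ }
              ; assoc = λ (a , b) (c , d) (e , f) → +-assoc a c e , +-assoc b d f }
            ; identity = (λ (a , b) → +-identityˡ a , +-identityˡ b)
                       , (λ (a , b) → +-identityʳ a , +-identityʳ b) }
          ; inverse = (λ (a , b) → -‿inverseˡ a , -‿inverseˡ b)
                    , (λ (a , b) → -‿inverseʳ a , -‿inverseʳ b)
          ; ⁻¹-cong = λ (p , q) → -‿cong p , -‿cong q }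
        ; comm = λ (a , b) (c , d) → +-comm a c , +-comm b d }
      ; *-cong = λ (p , q) (p′ , q′) →
          +-cong (*-cong p p′) (*-congˡ (*-cong q q′)) , +-cong (*-cong p q′) (*-cong q p′)
      ; *-assoc = λ (a , b) (c , d) (e , f) →
            solve 7 (λ a b c d e f w →
                (a :* c :+ w :* (b :* d)) :* e :+ w :* ((a :* d :+ b :* c) :* f)
             := a :* (c :* e :+ w :* (d :* f)) :+ w :* (b :* (c :* f :+ d :* e))) refl a b c d e f w
          , solve 7 (λ a b c d e f w →
                (a :* c :+ w :* (b :* d)) :* f :+ (a :* d :+ b :* c) :* e
             := a :* (c :* f :+ d :* e) :+ b :* (c :* e :+ w :* (d :* f))) refl a b c d e f w
      ; *-identity = (λ (a , b) →
              trans (+-cong (*-identityˡ a) (trans (*-congˡ (zeroˡ b)) (zeroʳ w))) (+-identityʳ a)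
            , trans (+-cong (*-identityˡ b) (zeroˡ a)) (+-identityʳ b))
          , (λ (a , b) →
              trans (+-cong (*-identityʳ a) (trans (*-congˡ (zeroʳ b)) (zeroʳ w))) (+-identityʳ a)
            , trans (+-cong (zeroʳ a) (*-identityʳ b)) (+-identityˡ b))
      ; distrib = (λ (a , b) (c , d) (e , f) →
            solve 7 (λ a b c d e f w → a :* (c :+ e) :+ w :* (b :* (d :+ f))
                                    := (a :* c :+ w :* (b :* d)) :+ (a :* e :+ w :* (b :* f))) refl a b c d e f w
          , solve 6 (λ a b c d e f → a :* (d :+ f) :+ b :* (c :+ e)
                                  := (a :* d :+ b :* c) :+ (a :* f :+ b :* e)) refl a b c d e f)
          , (λ (a , b) (c , d) (e , f) →
            solve 7 (λ a b c d e f w → (c :+ e) :* a :+ w :* ((d :+ f) :* b)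
                                    := (c :* a :+ w :* (d :* b)) :+ (e :* a :+ w :* (f :* b))) refl a b c d e f w
          , solve 6 (λ a b c d e f → (c :+ e) :* b :+ (d :+ f) :* a
                                  := (c :* b :+ d :* a) :+ (e :* b :+ f :* a)) refl a b c d e f)
      }
    ; *-comm = λ (a , b) (c , d) →
          solve 5 (λ a b c d w → a :* c :+ w :* (b :* d) := c :* a :+ w :* (d :* b)) refl a b c d w
        , solve 4 (λ a b c d → a :* d :+ b :* c := c :* b :+ d :* a) refl a b c d
    }

  quadraticRing : CommutativeRing c ℓ
  quadraticRing = record { isCommutativeRing = isCommutativeRing′ }

module FinInjection where

  open import Data.Nat using (suc)
  open import Data.Nat.Properties using (n<1+n)
  open import Data.Fin using (Fin; punchOut; _<_)
  open import Data.Fin.Properties using (any?; _≟_; pigeonhole; punchOut-injective; <⇒≢)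
  open import Data.Product using (∃; ∃₂; _×_; _,_)
  open import Data.Empty using (⊥; ⊥-elim)
  open import Function.Definitions using (Injective)
  open import Relation.Nullary using (yes; no)
  open import Relation.Binary.PropositionalEquality using (_≡_; _≢_; sym)

  -- Pigeonhole: a non-surjective f lands in n - 1 values once j is punched out.
  Fin-injective⇒surjective : ∀ {n} (f : Fin n → Fin n) → Injective _≡_ _≡_ f → ∀ j → ∃ λ i → f i ≡ j
  Fin-injective⇒surjective {suc n} f f-injective j with any? (λ i → f i ≟ j)
  ... | yes hit = hit
  ... | no miss = ⊥-elim (collision (pigeonhole (n<1+n n) (λ i → punchOut (j≢f i))))
    where
    j≢f : ∀ i → j ≢ f i
    j≢f i j≡fi = miss (i , sym j≡fi)
    collision : (∃₂ λ i i′ → i < i′ × punchOut (j≢f i) ≡ punchOut (j≢f i′)) → ⊥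
    collision (i , i′ , i<i′ , eq) = <⇒≢ i<i′ (f-injective (punchOut-injective (j≢f i) (j≢f i′) eq))

module FieldProperties {c ℓ : Level} {q : ℕ} (F : FiniteField c ℓ q) where

  open FiniteField F public
  open import Algebra.Properties.Ring ring public using (-‿involutive)
  open import Algebra.Properties.Group +-group public using (x∙y⁻¹≈ε⇒x≈y)
    renaming (quasigroup to +-quasigroup)
  open import Algebra.Properties.Quasigroup +-quasigroup public using ()
    renaming (cancelˡ to +-cancelˡ; cancelʳ to +-cancelʳ)
  open import Algebra.Properties.Semiring.Mult semiring public using (_×_; ×-homo-+; ×1-homo-*)
  open import Algebra.Properties.Semiring.Exp semiring public
    using (_^_; ^-congˡ; ^-homo-*; ^-assocʳ)
  open import Algebra.Properties.CommutativeSemiring.Exp commutativeSemiring public using (^-distrib-*)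
  open RingProperties commRing public
  open import Relation.Binary.Reasoning.Setoid setoid public

  open import Data.Nat as ℕ using (ℕ; zero; suc)
  open import Data.Integer using (+_; -[1+_])
  open import Data.Fin as Fin using (Fin)
  open import Data.Sum using (_⊎_; inj₁; inj₂)
  open import Data.Product using (_,_)
  open import Function.Bundles using (Inverse)
  open import Relation.Nullary using (¬_; Dec; yes; no; contradiction)
  open import Relation.Binary.PropositionalEquality as ≡ using (_≡_)

  module Enum = Inverse enum

  from-injective : ∀ {x y} → Enum.from x ≡ Enum.from y → x ≈ y
  from-injective {x} {y} eq =
    trans (sym (Enum.strictlyInverseˡ x)) (trans (reflexive (≡.cong Enum.to eq)) (Enum.strictlyInverseˡ y))

  to-injective : ∀ {i j} → Enum.to i ≈ Enum.to j → i ≡ j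
  to-injective {i} {j} eq =
    ≡.trans (≡.sym (Enum.strictlyInverseʳ i)) (≡.trans (Enum.from-cong eq) (Enum.strictlyInverseʳ j))

  natF≈×1 : ∀ n → natF F n ≈ n × 1#
  natF≈×1 zero    = refl
  natF≈×1 (suc n) = +-congˡ (natF≈×1 n)

  intF≈fromℤ : ∀ i → intF F i ≈ fromℤ i
  intF≈fromℤ (+ n)    = natF≈×1 n
  intF≈fromℤ -[1+ n ] = -‿cong (natF≈×1 (suc n))

  ^F≈^ : ∀ x n → _^F_ F x n ≈ x ^ n
  ^F≈^ x zero    = refl
  ^F≈^ x (suc n) = *-congˡ (^F≈^ x n)

  infix 4 _≟_
  _≟_ : ∀ x y → Dec (x ≈ y)
  x ≟ y with Enum.from x Fin.≟ Enum.from y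
  ... | yes eq = yes (from-injective eq)
  ... | no ne  = no λ x≈y → ne (Enum.from-cong x≈y)

  *-cancelˡ : ∀ {x y z} → ¬ (x ≈ 0#) → x * y ≈ x * z → y ≈ z
  *-cancelˡ {x} {y} {z} x≉0 xy≈xz with inverse x x≉0
  ... | x⁻¹ , xx⁻¹≈1 = begin
    y                 ≈⟨ lemma y ⟨
    x⁻¹ * (x * y)     ≈⟨ *-congˡ xy≈xz ⟩
    x⁻¹ * (x * z)     ≈⟨ lemma z ⟩
    z                 ∎
    where
    lemma : ∀ u → x⁻¹ * (x * u) ≈ u
    lemma u = trans (sym (*-assoc x⁻¹ x u))
                    (trans (*-congʳ (trans (*-comm x⁻¹ x) xx⁻¹≈1)) (*-identityˡ u))

  x≉0∧y≉0⇒x*y≉0 : ∀ {x y} → ¬ (x ≈ 0#) → ¬ (y ≈ 0#) → ¬ (x * y ≈ 0#)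
  x≉0∧y≉0⇒x*y≉0 {x} {y} x≉0 y≉0 xy≈0 = y≉0 (*-cancelˡ x≉0 (trans xy≈0 (sym (zeroʳ x))))

  x*y≈0⇒x≈0⊎y≈0 : ∀ {x y} → x * y ≈ 0# → x ≈ 0# ⊎ y ≈ 0#
  x*y≈0⇒x≈0⊎y≈0 {x} {y} xy≈0 with x ≟ 0# | y ≟ 0#
  ... | yes x≈0 | _       = inj₁ x≈0
  ... | no _    | yes y≈0 = inj₂ y≈0
  ... | no x≉0  | no y≉0  = contradiction xy≈0 (x≉0∧y≉0⇒x*y≉0 x≉0 y≉0)

  x≉0⇒x^n≉0 : ∀ {x} n → ¬ (x ≈ 0#) → ¬ (x ^ n ≈ 0#)
  x≉0⇒x^n≉0 zero    _   = 1≉0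
  x≉0⇒x^n≉0 (suc n) x≉0 = x≉0∧y≉0⇒x*y≉0 x≉0 (x≉0⇒x^n≉0 n x≉0)

  x^n≈0⇒x≈0 : ∀ {x} n → x ^ n ≈ 0# → x ≈ 0#
  x^n≈0⇒x≈0 {x} n xⁿ≈0 with x ≟ 0#
  ... | yes x≈0 = x≈0
  ... | no x≉0  = contradiction xⁿ≈0 (x≉0⇒x^n≉0 n x≉0)

module Counting {c ℓ : Level} {q : ℕ} (F : FiniteField c ℓ q) where

  open FieldProperties F
  open import Algebra.Properties.CommutativeMonoid.Sum +-commutativeMonoid as Σ using ()
  open import Algebra.Properties.CommutativeMonoid.Sum *-commutativeMonoid as Π using ()
  open import Data.Nat as ℕ using (zero; suc; _∸_; _<_)
  import Data.Nat.Properties as ℕ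
  open import Data.Nat.Primality using (Prime)
  open import Data.Nat.Coprimality using (prime⇒coprime; coprime-Bézout)
  open import Data.Nat.GCD using (module Bézout)
  open import Data.Fin as Fin using (Fin)
  open import Data.Fin.Properties using (punchInᵢ≢i)
  open import Data.Fin.Permutation using (Permutation; permutation; _⟨$⟩ʳ_)
  open import Data.Vec.Functional using (removeAt)
  open import Data.Product using (_,_; proj₁; proj₂)
  open import Function.Definitions using (Injective; Surjective; Congruent)
  open import Relation.Nullary using (¬_; yes; no; contradiction)
  open import Relation.Binary.PropositionalEquality as ≡ using (_≡_; _≢_)
  open import Function.Bundles using (_⇔_; mk⇔)
  open FinInjection using (Fin-injective⇒surjective)

  permutationOf : (f g : Carrier → Carrier) → Congruent _≈_ _≈_ f → Congruent _≈_ _≈_ g →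
                  (∀ y → f (g y) ≈ y) → (∀ x → g (f x) ≈ x) → Permutation q q
  permutationOf f g f-cong g-cong fg≈id gf≈id = permutation
    (λ i → Enum.from (f (Enum.to i))) (λ i → Enum.from (g (Enum.to i)))
    (λ i → to-injective (trans (Enum.strictlyInverseˡ _) (trans (f-cong (Enum.strictlyInverseˡ _)) (fg≈id _))))
    (λ i → to-injective (trans (Enum.strictlyInverseˡ _) (trans (g-cong (Enum.strictlyInverseˡ _)) (gf≈id _))))

  -- Translation by x permutes the field, so Σ a = Σ (a + x) = Σ a + q · x.
  q×x≈0 : ∀ x → q × x ≈ 0#
  q×x≈0 x = sym (+-cancelˡ S 0# (q × x) (trans (+-identityʳ S) S≈S+q×x))
    where
    S = Σ.sum Enum.to
    translation : Permutation q q
    translation = permutationOf (_+ x) (_- x) +-congʳ +-congʳ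
                    (λ y → solve 2 (λ y x → (y :- x) :+ x := y) refl y x)
                    (λ y → solve 2 (λ y x → (y :+ x) :- x := y) refl y x)
    S≈S+q×x : S ≈ S + q × x
    S≈S+q×x = begin
      S                                        ≈⟨ Σ.sum-permute Enum.to translation ⟩
      Σ.sum (λ i → Enum.to (translation ⟨$⟩ʳ i)) ≈⟨ Σ.sum-cong-≋ {q} (λ _ → Enum.inverseˡ ≡.refl) ⟩
      Σ.sum (λ i → Enum.to i + x)              ≈⟨ Σ.∑-distrib-+ {q} Enum.to (λ _ → x) ⟩
      S + Σ.sum {q} (λ _ → x)                  ≈⟨ +-congˡ (Σ.sum-replicate q) ⟩
      S + q × x                                ∎

  p×1≈0 : ∀ {p e} → q ≡ p ℕ.^ e → p × 1# ≈ 0#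
  p×1≈0 {p} {e} q≡pᵉ = x^n≈0⇒x≈0 e (begin
    (p × 1#) ^ e       ≈⟨ ×-^-homo e ⟨
    (p ℕ.^ e) × 1#     ≡⟨ ≡.cong (_× 1#) q≡pᵉ ⟨
    q × 1#             ≈⟨ q×x≈0 1# ⟩
    0#                 ∎)
    where
    ×-^-homo : ∀ n → (p ℕ.^ n) × 1# ≈ (p × 1#) ^ n
    ×-^-homo zero    = +-identityʳ 1#
    ×-^-homo (suc n) = trans (×1-homo-* p (p ℕ.^ n)) (*-congˡ (×-^-homo n))

  private
    1+a*b≢c*d : ∀ a {b} c {d} → b × 1# ≈ 0# → d × 1# ≈ 0# → 1 ℕ.+ a ℕ.* b ≢ c ℕ.* d
    1+a*b≢c*d a {b} c {d} b≈0 d≈0 eq = 1≉0 (begin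
      1#                             ≈⟨ +-identityʳ 1# ⟨
      1# + 0#                        ≈⟨ +-congˡ (trans (*-congˡ b≈0) (zeroʳ _)) ⟨
      1# + (a × 1#) * (b × 1#)       ≈⟨ +-congˡ (×1-homo-* a b) ⟨
      (1 ℕ.+ a ℕ.* b) × 1#           ≡⟨ ≡.cong (_× 1#) eq ⟩
      (c ℕ.* d) × 1#                 ≈⟨ ×1-homo-* c d ⟩
      (c × 1#) * (d × 1#)            ≈⟨ *-congˡ d≈0 ⟩
      (c × 1#) * 0#                  ≈⟨ zeroʳ _ ⟩
      0#                             ∎)

  ×1≉0 : ∀ {p j} → Prime p → p × 1# ≈ 0# → 0 < j → j < p → ¬ (j × 1# ≈ 0#)
  ×1≉0 p-prime p≈0 (ℕ.s≤s _) j<p j≈0 with coprime-Bézout (prime⇒coprime p-prime j<p)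
  ... | Bézout.+- x y eq = 1+a*b≢c*d y x j≈0 p≈0 eq
  ... | Bézout.-+ x y eq = 1+a*b≢c*d x y p≈0 j≈0 eq

  k×1≉0⇔k≢0 : ∀ {p k} → Prime p → p × 1# ≈ 0# → k < p → (¬ (k × 1# ≈ 0#)) ⇔ (k ≢ 0)
  k×1≉0⇔k≢0 p-prime p×1≈0 k<p = mk⇔
    (λ k×1≉0 k≡0 → k×1≉0 (reflexive (≡.cong (_× 1#) k≡0)))
    (λ k≢0 → ×1≉0 p-prime p×1≈0 (ℕ.n≢0⇒n>0 k≢0) k<p)

  injective⇒surjective : ∀ (f : Carrier → Carrier) → Congruent _≈_ _≈_ f → Injective _≈_ _≈_ f →
                         Surjective _≈_ _≈_ f
  injective⇒surjective f f-cong f-injective y =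
    let i , f̂i≡y = Fin-injective⇒surjective f̂ f̂-injective (Enum.from y)
    in Enum.to i , λ z≈toi → trans (f-cong z≈toi) (from-injective f̂i≡y)
    where
    f̂ : Fin q → Fin q
    f̂ i = Enum.from (f (Enum.to i))
    f̂-injective : Injective _≡_ _≡_ f̂
    f̂-injective f̂i≡f̂j = to-injective (f-injective (from-injective f̂i≡f̂j))

  ∏≉0 : ∀ {n} (t : Fin n → Carrier) → (∀ i → ¬ (t i ≈ 0#)) → ¬ (Π.sum t ≈ 0#)
  ∏≉0 {zero}  t t≉0 = 1≉0
  ∏≉0 {suc n} t t≉0 =
    x≉0∧y≉0⇒x*y≉0 (t≉0 Fin.zero) (∏≉0 (λ i → t (Fin.suc i)) (λ i → t≉0 (Fin.suc i)))

  ∏-except≈^ : ∀ {n} (z : Fin n) a (t : Fin n → Carrier) → t z ≈ 1# → (∀ j → j ≢ z → t j ≈ a) →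
               Π.sum t ≈ a ^ (n ∸ 1)
  ∏-except≈^ {suc n} z a t tz≈1 tj≈a = begin
    Π.sum t                          ≈⟨ Π.sum-remove t ⟩
    t z * Π.sum (removeAt t z)       ≈⟨ *-cong tz≈1 (Π.sum-cong-≋ {n} (λ j → tj≈a _ (punchInᵢ≢i z j))) ⟩
    1# * Π.sum {n} (λ _ → a)         ≈⟨ *-identityˡ _ ⟩
    Π.sum {n} (λ _ → a)              ≈⟨ Π.sum-replicate n ⟩
    a ^ n                            ∎

  -- Multiplication by a ≉ 0 permutes the nonzero elements; compare their products.
  fermat : ∀ {a} → ¬ (a ≈ 0#) → a ^ (q ∸ 1) ≈ 1#
  fermat {a} a≉0 = *-cancelˡ P≉0 (begin
    P * a ^ (q ∸ 1)   ≈⟨ *-comm P _ ⟩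
    a ^ (q ∸ 1) * P   ≈⟨ P≈aⁿP ⟨
    P                 ≈⟨ *-identityʳ P ⟨
    P * 1#            ∎)
    where
    a⁻¹ = proj₁ (inverse a a≉0)
    aa⁻¹≈1 = proj₂ (inverse a a≉0)

    nonzero : Carrier → Carrier
    nonzero y with y ≟ 0#
    ... | yes _ = 1#
    ... | no _  = y

    factor : Carrier → Carrier
    factor y with y ≟ 0#
    ... | yes _ = 1#
    ... | no _  = a

    nonzero≉0 : ∀ y → ¬ (nonzero y ≈ 0#)
    nonzero≉0 y with y ≟ 0#
    ... | yes _   = 1≉0
    ... | no y≉0 = y≉0

    nonzero-cong : Congruent _≈_ _≈_ nonzero
    nonzero-cong {x} {y} x≈y with x ≟ 0# | y ≟ 0#
    ... | yes _   | yes _   = refl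
    ... | yes x≈0 | no y≉0  = contradiction (trans (sym x≈y) x≈0) y≉0
    ... | no x≉0  | yes y≈0 = contradiction (trans x≈y y≈0) x≉0
    ... | no _    | no _    = x≈y

    nonzero-* : ∀ y → nonzero (a * y) ≈ factor y * nonzero y
    nonzero-* y with y ≟ 0# | a * y ≟ 0#
    ... | yes _   | yes _    = sym (*-identityˡ 1#)
    ... | yes y≈0 | no ay≉0  = contradiction (trans (*-congˡ y≈0) (zeroʳ a)) ay≉0
    ... | no y≉0  | yes ay≈0 = contradiction ay≈0 (x≉0∧y≉0⇒x*y≉0 a≉0 y≉0)
    ... | no _    | no _     = refl

    zero-index : Fin q
    zero-index = Enum.from 0#

    factor-zero : factor (Enum.to zero-index) ≈ 1#
    factor-zero with Enum.to zero-index ≟ 0#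
    ... | yes _  = refl
    ... | no ≉0 = contradiction (Enum.strictlyInverseˡ 0#) ≉0

    factor-nonzero : ∀ j → j ≢ zero-index → factor (Enum.to j) ≈ a
    factor-nonzero j j≢z with Enum.to j ≟ 0#
    ... | yes toj≈0 = contradiction (to-injective (trans toj≈0 (sym (Enum.strictlyInverseˡ 0#)))) j≢z
    ... | no _      = refl

    scaling : Permutation q q
    scaling = permutationOf (a *_) (a⁻¹ *_) *-congˡ *-congˡ
      (λ y → trans (sym (*-assoc a a⁻¹ y)) (trans (*-congʳ aa⁻¹≈1) (*-identityˡ y)))
      (λ y → trans (sym (*-assoc a⁻¹ a y)) (trans (*-congʳ (trans (*-comm a⁻¹ a) aa⁻¹≈1)) (*-identityˡ y)))

    P : Carrier
    P = Π.sum (λ i → nonzero (Enum.to i))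

    P≉0 : ¬ (P ≈ 0#)
    P≉0 = ∏≉0 _ (λ i → nonzero≉0 (Enum.to i))

    P≈aⁿP : P ≈ a ^ (q ∸ 1) * P
    P≈aⁿP = begin
      P                                                ≈⟨ Π.sum-permute _ scaling ⟩
      Π.sum (λ i → nonzero (Enum.to (scaling ⟨$⟩ʳ i)))
        ≈⟨ Π.sum-cong-≋ {q} (λ i → nonzero-cong (Enum.strictlyInverseˡ _)) ⟩
      Π.sum (λ i → nonzero (a * Enum.to i))            ≈⟨ Π.sum-cong-≋ {q} (λ i → nonzero-* (Enum.to i)) ⟩
      Π.sum (λ i → factor (Enum.to i) * nonzero (Enum.to i))
        ≈⟨ Π.∑-distrib-+ {q} (λ i → factor (Enum.to i)) (λ i → nonzero (Enum.to i)) ⟩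
      Π.sum (λ i → factor (Enum.to i)) * P
        ≈⟨ *-congʳ (∏-except≈^ zero-index a _ factor-zero factor-nonzero) ⟩
      a ^ (q ∸ 1) * P                                  ∎

module MonicPolynomial {c ℓ : Level} {q : ℕ} (F : FiniteField c ℓ q) where

  open FieldProperties F
  open import Data.Nat as ℕ using (zero; suc; _≤_; z≤n; s≤s)
  open import Data.Vec using (Vec; []; _∷_)
  open import Data.Fin as Fin using (Fin)
  open import Data.Fin.Properties using (suc-injective)
  open import Data.Sum using (inj₁; inj₂)
  open import Relation.Nullary using (contradiction)
  open import Relation.Binary.PropositionalEquality using (_≡_)

  -- The coefficient vector c₀ ∷ … ∷ c_{d-1} stands for c₀ + c₁ x + … + c_{d-1} x^{d-1} + x^d.
  eval : ∀ {d} → Vec Carrier d → Carrier → Carrier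
  eval []       x = 1#
  eval (c ∷ cs) x = c + x * eval cs x

  quotient : ∀ {d} → Vec Carrier (suc d) → Carrier → Vec Carrier d
  quotient (c ∷ [])     a = []
  quotient (c ∷ c′ ∷ cs) a = eval (c′ ∷ cs) a ∷ quotient (c′ ∷ cs) a

  eval-quotient : ∀ {d} (cs : Vec Carrier (suc d)) a x →
                  eval cs x ≈ (x - a) * eval (quotient cs a) x + eval cs a
  eval-quotient (c ∷ [])      a x =
    solve 4 (λ c a x o → c :+ x :* o := (x :- a) :* o :+ (c :+ a :* o)) refl c a x 1#
  eval-quotient (c ∷ c′ ∷ cs) a x = begin
    c + x * eval (c′ ∷ cs) x              ≈⟨ +-congˡ (*-congˡ (eval-quotient (c′ ∷ cs) a x)) ⟩
    c + x * ((x - a) * Q + r)             ≈⟨ solve 5 (λ c x a Q r → c :+ x :* ((x :- a) :* Q :+ r)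
                                                       := (x :- a) :* (r :+ x :* Q) :+ (c :+ a :* r))
                                                     refl c x a Q r ⟩
    (x - a) * (r + x * Q) + (c + a * r)   ∎
    where
    Q = eval (quotient (c′ ∷ cs) a) x
    r = eval (c′ ∷ cs) a

  roots≤degree : ∀ {d t} (cs : Vec Carrier d) (r : Fin t → Carrier) → (∀ {i j} → r i ≈ r j → i ≡ j) →
                 (∀ i → eval cs (r i) ≈ 0#) → t ≤ d
  roots≤degree {t = zero}          cs r r-injective roots = z≤n
  roots≤degree {zero}    {suc t}   [] r r-injective roots = contradiction (roots Fin.zero) 1≉0
  roots≤degree {suc d}   {suc t}   cs r r-injective roots =
    s≤s (roots≤degree (quotient cs a) (λ i → r (Fin.suc i)) (λ eq → suc-injective (r-injective eq)) roots′)
    where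
    a = r Fin.zero
    roots′ : ∀ i → eval (quotient cs a) (r (Fin.suc i)) ≈ 0#
    roots′ i with x*y≈0⇒x≈0⊎y≈0 (begin
        (r (Fin.suc i) - a) * eval (quotient cs a) (r (Fin.suc i))
          ≈⟨ +-identityʳ _ ⟨
        (r (Fin.suc i) - a) * eval (quotient cs a) (r (Fin.suc i)) + 0#
          ≈⟨ +-congˡ (roots Fin.zero) ⟨
        (r (Fin.suc i) - a) * eval (quotient cs a) (r (Fin.suc i)) + eval cs a
          ≈⟨ eval-quotient cs a (r (Fin.suc i)) ⟨
        eval cs (r (Fin.suc i))
          ≈⟨ roots (Fin.suc i) ⟩
        0# ∎)
    ... | inj₁ rᵢ-a≈0 = contradiction (r-injective (sym (x∙y⁻¹≈ε⇒x≈y _ _ rᵢ-a≈0))) λ ()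
    ... | inj₂ Q≈0    = Q≈0

module PowerMap {c ℓ : Level} {q : ℕ} (F : FiniteField c ℓ q) where

  open FieldProperties F
  open Counting F using (fermat)
  open MonicPolynomial F using (eval; roots≤degree)
  open import Data.Nat as ℕ using (zero; suc; _∸_; _≤_; _<_; z≤n; s≤s)
  import Data.Nat.Properties as ℕ
  open import Data.Nat.GCD using (gcd; gcd[m,n]∣m; gcd[m,n]∣n; module Bézout)
  open import Data.Nat.Coprimality using (gcd≡1⇒coprime; coprime-Bézout)
  open import Data.Nat.Divisibility using (divides)
  open import Data.Nat.Tactic.RingSolver using (solve-∀)
  open import Data.Vec using (_∷_; replicate)
  open import Data.Fin as Fin using (Fin)
  open import Data.Product using (proj₁; proj₂)
  open import Function.Bundles using (_⇔_; mk⇔)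
  open import Function.Definitions using (Injective)
  open import Relation.Nullary using (¬_; yes; no; contradiction)
  open import Relation.Binary.PropositionalEquality as ≡ using (_≡_; _≢_)

  1<q : 1 < q
  1<q = distinct⇒1<n (Enum.from 0#) (Enum.from 1#) (λ eq → 1≉0 (sym (from-injective eq)))
    where
    distinct⇒1<n : ∀ {n} (i j : Fin n) → i ≢ j → 1 < n
    distinct⇒1<n {suc zero}    Fin.zero Fin.zero i≢j = contradiction ≡.refl i≢j
    distinct⇒1<n {suc (suc n)} _        _        _   = s≤s (s≤s z≤n)

  q∸1≢0 : q ∸ 1 ≢ 0
  q∸1≢0 q∸1≡0 = ℕ.<⇒≱ 1<q (ℕ.m∸n≡0⇒m≤n q∸1≡0)

  private
    c^a≈1∧c^b≈1⇒c≈1 : ∀ {c′} a b x y → c′ ^ a ≈ 1# → c′ ^ b ≈ 1# →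
                      1 ℕ.+ x ℕ.* a ≡ y ℕ.* b → c′ ≈ 1#
    c^a≈1∧c^b≈1⇒c≈1 {c′} a b x y cᵃ≈1 cᵇ≈1 eq = begin
      c′                        ≈⟨ *-identityʳ c′ ⟨
      c′ * 1#                   ≈⟨ *-congˡ (1^n≈1 x) ⟨
      c′ * 1# ^ x               ≈⟨ *-congˡ (^-congˡ x cᵃ≈1) ⟨
      c′ * (c′ ^ a) ^ x         ≈⟨ *-congˡ (^-assocʳ c′ a x) ⟩
      c′ ^ (1 ℕ.+ a ℕ.* x)      ≡⟨ ≡.cong (λ e → c′ ^ (1 ℕ.+ e)) (ℕ.*-comm a x) ⟩
      c′ ^ (1 ℕ.+ x ℕ.* a)      ≡⟨ ≡.cong (c′ ^_) (≡.trans eq (ℕ.*-comm y b)) ⟩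
      c′ ^ (b ℕ.* y)            ≈⟨ ^-assocʳ c′ b y ⟨
      (c′ ^ b) ^ y              ≈⟨ ^-congˡ y cᵇ≈1 ⟩
      1# ^ y                    ≈⟨ 1^n≈1 y ⟩
      1#                        ∎

  root-of-unity≈1 : ∀ m {u} → gcd m (q ∸ 1) ≡ 1 → ¬ (u ≈ 0#) → u ^ m ≈ 1# → u ≈ 1#
  root-of-unity≈1 m gcd≡1 u≉0 uᵐ≈1 with coprime-Bézout (gcd≡1⇒coprime gcd≡1)
  ... | Bézout.+- x y eq = c^a≈1∧c^b≈1⇒c≈1 (q ∸ 1) m y x (fermat u≉0) uᵐ≈1 eq
  ... | Bézout.-+ x y eq = c^a≈1∧c^b≈1⇒c≈1 m (q ∸ 1) x y uᵐ≈1 (fermat u≉0) eq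

  gcd≡1⇒^-injective : ∀ {m} → 0 < m → gcd m (q ∸ 1) ≡ 1 → Injective _≈_ _≈_ (_^ m)
  gcd≡1⇒^-injective {suc m′} _ gcd≡1 {a} {b} aᵐ≈bᵐ with b ≟ 0#
  ... | yes b≈0 = trans (x^n≈0⇒x≈0 m (trans aᵐ≈bᵐ (trans (*-congʳ b≈0) (zeroˡ _)))) (sym b≈0)
    where m = suc m′
  ... | no b≉0 = begin
    a                 ≈⟨ *-identityʳ a ⟨
    a * 1#            ≈⟨ *-congˡ bb⁻¹≈1 ⟨
    a * (b * b⁻¹)     ≈⟨ solve 3 (λ a b b⁻¹ → a :* (b :* b⁻¹) := b :* (a :* b⁻¹)) refl a b b⁻¹ ⟩
    b * (a * b⁻¹)     ≈⟨ *-congˡ (root-of-unity≈1 m gcd≡1 ab⁻¹≉0 [ab⁻¹]ᵐ≈1) ⟩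
    b * 1#            ≈⟨ *-identityʳ b ⟩
    b                 ∎
    where
    m = suc m′
    b⁻¹ = proj₁ (inverse b b≉0)
    bb⁻¹≈1 = proj₂ (inverse b b≉0)
    [ab⁻¹]ᵐ≈1 : (a * b⁻¹) ^ m ≈ 1#
    [ab⁻¹]ᵐ≈1 = begin
      (a * b⁻¹) ^ m     ≈⟨ ^-distrib-* a b⁻¹ m ⟩
      a ^ m * b⁻¹ ^ m   ≈⟨ *-congʳ aᵐ≈bᵐ ⟩
      b ^ m * b⁻¹ ^ m   ≈⟨ ^-distrib-* b b⁻¹ m ⟨
      (b * b⁻¹) ^ m     ≈⟨ ^-congˡ m bb⁻¹≈1 ⟩
      1# ^ m            ≈⟨ 1^n≈1 m ⟩
      1#                ∎
    ab⁻¹≉0 : ¬ (a * b⁻¹ ≈ 0#)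
    ab⁻¹≉0 ab⁻¹≈0 = 1≉0 (trans (sym [ab⁻¹]ᵐ≈1) (trans (^-congˡ m ab⁻¹≈0) (zeroˡ _)))

  -- Every element is a root of x^(s+2) - x.
  roots-of-unity-bound : ∀ {s} → (∀ {a} → ¬ (a ≈ 0#) → a ^ suc s ≈ 1#) → q ≤ suc (suc s)
  roots-of-unity-bound {s} aˢ⁺¹≈1 = roots≤degree (0# ∷ - 1# ∷ replicate s 0#) Enum.to to-injective root
    where
    eval-zeros : ∀ n x → eval (replicate n 0#) x ≈ x ^ n
    eval-zeros zero    x = refl
    eval-zeros (suc n) x = trans (+-identityˡ _) (*-congˡ (eval-zeros n x))
    root : ∀ i → eval (0# ∷ - 1# ∷ replicate s 0#) (Enum.to i) ≈ 0#
    root i with Enum.to i ≟ 0#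
    ... | yes x≈0 = trans (+-identityˡ _) (trans (*-congʳ x≈0) (zeroˡ _))
    ... | no x≉0  = trans (+-identityˡ _) (trans (*-congˡ (begin
      - 1# + Enum.to i * eval (replicate s 0#) (Enum.to i) ≈⟨ +-congˡ (*-congˡ (eval-zeros s _)) ⟩
      - 1# + Enum.to i ^ suc s                             ≈⟨ +-congˡ (aˢ⁺¹≈1 x≉0) ⟩
      - 1# + 1#                                            ≈⟨ -‿inverseˡ 1# ⟩
      0#                                                   ∎)) (zeroʳ _))

  -- If d = gcd m (q - 1) ≥ 2, injectivity makes every unit a ((q - 1)/d)-th root of unity: too many roots.
  ^-injective⇒gcd≡1 : ∀ m → Injective _≈_ _≈_ (_^ m) → gcd m (q ∸ 1) ≡ 1
  ^-injective⇒gcd≡1 m ^m-injective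
    with gcd m (q ∸ 1) | gcd[m,n]∣m m (q ∸ 1) | gcd[m,n]∣n m (q ∸ 1)
  ... | 0        | _              | divides s q-1≡s*0 = contradiction (≡.trans q-1≡s*0 (ℕ.*-zeroʳ s)) q∸1≢0
  ... | 1        | _              | _                 = ≡.refl
  ... | suc (suc g) | _           | divides 0 q-1≡0   = contradiction q-1≡0 q∸1≢0
  ... | suc (suc g) | divides t m≡t*d | divides (suc s) q-1≡s*d =
    contradiction (roots-of-unity-bound aˢ⁺¹≈1) (ℕ.<⇒≱ q>s+2)
    where
    d = suc (suc g)
    aˢ⁺¹≈1 : ∀ {a} → ¬ (a ≈ 0#) → a ^ suc s ≈ 1#
    aˢ⁺¹≈1 {a} a≉0 = ^m-injective (begin
      (a ^ suc s) ^ m             ≈⟨ ^-assocʳ a (suc s) m ⟩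
      a ^ (suc s ℕ.* m)           ≡⟨ ≡.cong (λ e → a ^ (suc s ℕ.* e)) m≡t*d ⟩
      a ^ (suc s ℕ.* (t ℕ.* d))   ≡⟨ ≡.cong (a ^_) (exponent (suc s) t d) ⟩
      a ^ ((suc s ℕ.* d) ℕ.* t)   ≡⟨ ≡.cong (λ e → a ^ (e ℕ.* t)) q-1≡s*d ⟨
      a ^ ((q ∸ 1) ℕ.* t)         ≈⟨ ^-assocʳ a (q ∸ 1) t ⟨
      (a ^ (q ∸ 1)) ^ t           ≈⟨ ^-congˡ t (fermat a≉0) ⟩
      1# ^ t                      ≈⟨ 1^n≈1 t ⟩
      1#                          ≈⟨ 1^n≈1 m ⟨
      1# ^ m                      ∎)
      where
      exponent : ∀ s t d → s ℕ.* (t ℕ.* d) ≡ (s ℕ.* d) ℕ.* t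
      exponent = solve-∀
    q>s+2 : suc (suc s) < q
    q>s+2 = ≡.subst (suc (suc s) <_) (ℕ.m+[n∸m]≡n (ℕ.<⇒≤ 1<q))
      (s≤s (ℕ.≤-trans (s≤s (s≤s (ℕ.m≤m*n s 2)))
           (ℕ.≤-trans (ℕ.*-monoʳ-≤ (suc s) (s≤s (s≤s z≤n))) (ℕ.≤-reflexive (≡.sym q-1≡s*d)))))

  ^-injective⇔gcd≡1 : ∀ {m} → 0 < m → Injective _≈_ _≈_ (_^ m) ⇔ gcd m (q ∸ 1) ≡ 1
  ^-injective⇔gcd≡1 {m} 0<m = mk⇔ (^-injective⇒gcd≡1 m) (gcd≡1⇒^-injective 0<m)

module DicksonSums {c ℓ : Level} {q : ℕ} (F : FiniteField c ℓ q) where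

  open FieldProperties F
  open Binomial using (choose; k>n⇒choose≡0)
  open DicksonCoefficients using (dicksonCoeff-zero; dicksonCoeff-suc)
  open Arithmetic using ([1+m+m]/2≡m; N∸i<i)
  open import Data.Nat as ℕ using (zero; suc; _∸_; _≤_; _<_; z≤n; s≤s)
  import Data.Nat.Properties as ℕ
  open import Data.Integer as ℤ using (+_)
  open import Relation.Binary.PropositionalEquality as ≡ using (_≡_)

  -- Σ M f = f 0 + … + f M: the upper bound is included.
  Σ : ℕ → (ℕ → Carrier) → Carrier
  Σ = sumF F

  Σ-cong : ∀ M {f g} → (∀ i → i ≤ M → f i ≈ g i) → Σ M f ≈ Σ M g
  Σ-cong zero    f≈g = f≈g 0 z≤n
  Σ-cong (suc M) f≈g = +-cong (Σ-cong M (λ i i≤M → f≈g i (ℕ.m≤n⇒m≤1+n i≤M))) (f≈g (suc M) ℕ.≤-refl)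

  Σ-suc : ∀ M f → Σ (suc M) f ≈ f 0 + Σ M (λ i → f (suc i))
  Σ-suc zero    f = refl
  Σ-suc (suc M) f = trans (+-congʳ (Σ-suc M f)) (+-assoc _ _ _)

  Σ-+ : ∀ M f g → Σ M (λ i → f i + g i) ≈ Σ M f + Σ M g
  Σ-+ zero    f g = refl
  Σ-+ (suc M) f g = trans (+-congʳ (Σ-+ M f g))
    (solve 4 (λ a b c d → (a :+ b) :+ (c :+ d) := (a :+ c) :+ (b :+ d)) refl _ _ _ _)

  Σ-*ˡ : ∀ M a f → Σ M (λ i → a * f i) ≈ a * Σ M f
  Σ-*ˡ zero    a f = refl
  Σ-*ˡ (suc M) a f = trans (+-congʳ (Σ-*ˡ M a f)) (sym (distribˡ a _ _))

  Σ-extend : ∀ M d f → (∀ i → M < i → f i ≈ 0#) → Σ (d ℕ.+ M) f ≈ Σ M f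
  Σ-extend M zero    f f≈0 = refl
  Σ-extend M (suc d) f f≈0 =
    trans (+-congˡ (f≈0 _ (s≤s (ℕ.m≤n+m M d)))) (trans (+-identityʳ _) (Σ-extend M d f f≈0))

  fibonacciTerm : ℕ → Carrier → ℕ → Carrier
  fibonacciTerm N y i = choose (N ∸ i) i × 1# * y ^ i

  -- A sum along a shallow diagonal of Pascal's triangle; fibonacci N 1 is the (N+1)-st Fibonacci number.
  fibonacci : ℕ → Carrier → Carrier
  fibonacci N y = Σ N (fibonacciTerm N y)

  fibonacciTerm≈0 : ∀ N y i → N ∸ i < i → fibonacciTerm N y i ≈ 0#
  fibonacciTerm≈0 N y i N∸i<i =
    trans (*-congʳ (reflexive (≡.cong (_× 1#) (k>n⇒choose≡0 N∸i<i)))) (zeroˡ _)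

  fibonacci-rec : ∀ N y → fibonacci (suc (suc N)) y ≈ fibonacci (suc N) y + y * fibonacci N y
  fibonacci-rec N y = begin
    Σ (suc N) t₂ + t₂ (suc (suc N))
      ≈⟨ +-congˡ (fibonacciTerm≈0 (suc (suc N)) y (suc (suc N))
                    (≡.subst (_< suc (suc N)) (≡.sym (ℕ.n∸n≡0 N)) (s≤s z≤n))) ⟩
    Σ (suc N) t₂ + 0#                                         ≈⟨ +-identityʳ _ ⟩
    Σ (suc N) t₂                                              ≈⟨ Σ-suc N t₂ ⟩
    t₂ 0 + Σ N (λ i → t₂ (suc i))                             ≈⟨ +-congˡ (Σ-cong N pascal) ⟩
    t₂ 0 + Σ N (λ i → t₁ (suc i) + y * t₀ i)                  ≈⟨ +-congˡ (Σ-+ N _ _) ⟩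
    t₂ 0 + (Σ N (λ i → t₁ (suc i)) + Σ N (λ i → y * t₀ i))    ≈⟨ +-assoc _ _ _ ⟨
    (t₁ 0 + Σ N (λ i → t₁ (suc i))) + Σ N (λ i → y * t₀ i)    ≈⟨ +-cong (sym (Σ-suc N t₁)) (Σ-*ˡ N y t₀) ⟩
    fibonacci (suc N) y + y * fibonacci N y                   ∎
    where
    t₂ = fibonacciTerm (suc (suc N)) y
    t₁ = fibonacciTerm (suc N) y
    t₀ = fibonacciTerm N y
    pascal : ∀ i → i ≤ N → t₂ (suc i) ≈ t₁ (suc i) + y * t₀ i
    pascal i i≤N rewrite ℕ.+-∸-assoc 1 i≤N = begin
      (choose (N ∸ i) i ℕ.+ choose (N ∸ i) (suc i)) × 1# * (y * y ^ i)
        ≈⟨ *-congʳ (×-homo-+ 1# (choose (N ∸ i) i) (choose (N ∸ i) (suc i))) ⟩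
      (a + b) * (y * y ^ i)
        ≈⟨ solve 4 (λ a b y t → (a :+ b) :* (y :* t) := b :* (y :* t) :+ y :* (a :* t)) refl _ _ _ _ ⟩
      b * (y * y ^ i) + y * (a * y ^ i) ∎
      where
      a = choose (N ∸ i) i × 1#
      b = choose (N ∸ i) (suc i) × 1#

  fibonacci-truncate : ∀ {N} M y → M ≤ N → N ≤ M ℕ.+ suc M → Σ M (fibonacciTerm N y) ≈ fibonacci N y
  fibonacci-truncate {N} M y M≤N N≤2M+1 = begin
    Σ M t                    ≈⟨ Σ-extend M (N ∸ M) t (λ i M<i → fibonacciTerm≈0 N y i (N∸i<i N≤2M+1 M<i)) ⟨
    Σ (N ∸ M ℕ.+ M) t        ≡⟨ ≡.cong (λ n → Σ n t) (ℕ.m∸n+n≡m M≤N) ⟩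
    Σ N t                    ∎
    where t = fibonacciTerm N y

  intF-dicksonCoeff-suc : ∀ N j k → intF F (dicksonCoeff (suc N ℕ.+ suc j) k (suc j))
                                      ≈ choose (suc N) (suc j) × 1# + (1# - k × 1#) * choose N j × 1#
  intF-dicksonCoeff-suc N j k = begin
    intF F (dicksonCoeff (suc N ℕ.+ suc j) k (suc j))
      ≡⟨ ≡.cong (intF F) (dicksonCoeff-suc N j k) ⟩
    intF F (+ A ℤ.+ (+ 1 ℤ.- + k) ℤ.* + B)
      ≈⟨ intF≈fromℤ (+ A ℤ.+ (+ 1 ℤ.- + k) ℤ.* + B) ⟩
    fromℤ (+ A ℤ.+ (+ 1 ℤ.- + k) ℤ.* + B)
      ≈⟨ fromℤ-+-homo (+ A) ((+ 1 ℤ.- + k) ℤ.* + B) ⟩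
    A × 1# + fromℤ ((+ 1 ℤ.- + k) ℤ.* + B)
      ≈⟨ +-congˡ (fromℤ-*-homo (+ 1 ℤ.- + k) (+ B)) ⟩
    A × 1# + fromℤ (+ 1 ℤ.- + k) * B × 1#
      ≈⟨ +-congˡ (*-congʳ (fromℤ-+-homo (+ 1) (ℤ.- + k))) ⟩
    A × 1# + (1 × 1# + fromℤ (ℤ.- + k)) * B × 1#
      ≈⟨ +-congˡ (*-congʳ (+-cong (+-identityʳ 1#) (fromℤ-‿homo (+ k)))) ⟩
    A × 1# + (1# - k × 1#) * B × 1#  ∎
    where
    A = choose (suc N) (suc j)
    B = choose N j

  dickson≈fibonacci : ∀ m k x →
    D F (3 ℕ.+ (m ℕ.+ m)) k x
      ≈ fibonacci (3 ℕ.+ (m ℕ.+ m)) (- x) + (1# - k × 1#) * (- x * fibonacci (1 ℕ.+ (m ℕ.+ m)) (- x))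
  dickson≈fibonacci m k x = begin
    D F n k x
      ≡⟨ ≡.cong (λ M → Σ M term) n/2≡1+m ⟩
    Σ (suc m) term
      ≈⟨ Σ-suc m term ⟩
    term 0 + Σ m (λ j → term (suc j))
      ≈⟨ +-cong term-zero (Σ-cong m term-suc) ⟩
    t 0 + Σ m (λ j → t (suc j) + K′ * (y * t′ j))
      ≈⟨ +-congˡ (Σ-+ m _ _) ⟩
    t 0 + (Σ m (λ j → t (suc j)) + Σ m (λ j → K′ * (y * t′ j)))
      ≈⟨ +-assoc _ _ _ ⟨
    (t 0 + Σ m (λ j → t (suc j))) + Σ m (λ j → K′ * (y * t′ j))
      ≈⟨ +-cong (sym (Σ-suc m t)) (trans (Σ-*ˡ m K′ _) (*-congˡ (Σ-*ˡ m y t′))) ⟩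
    Σ (suc m) t + K′ * (y * Σ m t′)
      ≈⟨ +-cong (fibonacci-truncate (suc m) y (s≤s (ℕ.m≤n+m m _)) (ℕ.≤-reflexive n≡1+2[1+m]))
                (*-congˡ (*-congˡ (fibonacci-truncate m y (ℕ.m≤n+m m _) (ℕ.≤-reflexive (≡.sym (ℕ.+-suc m m)))))) ⟩
    fibonacci n y + K′ * (y * fibonacci N y) ∎
    where
    N = suc (m ℕ.+ m)
    n = suc (suc N)
    y = - x
    K′ = 1# - k × 1#
    term : ℕ → Carrier
    term i = intF F (dicksonCoeff n k i) * _^F_ F y i
    t = fibonacciTerm n y
    t′ = fibonacciTerm N y

    n≡1+2[1+m] : n ≡ suc m ℕ.+ suc (suc m)
    n≡1+2[1+m] = ≡.cong suc (≡.sym (≡.trans (ℕ.+-suc m (suc m)) (≡.cong suc (ℕ.+-suc m m))))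

    n/2≡1+m : n ℕ./ 2 ≡ suc m
    n/2≡1+m = ≡.trans (≡.cong (λ z → suc (suc z) ℕ./ 2) (≡.sym (ℕ.+-suc m m))) ([1+m+m]/2≡m (suc m))

    term-zero : term 0 ≈ t 0
    term-zero = reflexive (≡.cong (λ z → intF F z * 1#) (dicksonCoeff-zero (suc N) k))

    term-suc : ∀ j → j ≤ m → term (suc j) ≈ t (suc j) + K′ * (y * t′ j)
    term-suc j j≤m = begin
      intF F (dicksonCoeff n k (suc j)) * (y * _^F_ F y j)
        ≡⟨ ≡.cong (λ z → intF F (dicksonCoeff z k (suc j)) * (y * _^F_ F y j)) n≡ ⟨
      intF F (dicksonCoeff (suc (N ∸ j) ℕ.+ suc j) k (suc j)) * (y * _^F_ F y j)
        ≈⟨ *-cong (intF-dicksonCoeff-suc (N ∸ j) j k) (*-congˡ (^F≈^ y j)) ⟩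
      (A × 1# + K′ * B × 1#) * (y * y ^ j)
        ≈⟨ solve 5 (λ a b K y yʲ → (a :+ K :* b) :* (y :* yʲ) := a :* (y :* yʲ) :+ K :* (y :* (b :* yʲ)))
                 refl _ _ _ _ _ ⟩
      A × 1# * (y * y ^ j) + K′ * (y * (B × 1# * y ^ j))
        ≡⟨ ≡.cong (λ z → choose z (suc j) × 1# * (y * y ^ j) + K′ * (y * t′ j)) (ℕ.+-∸-assoc 1 j≤N) ⟨
      t (suc j) + K′ * (y * t′ j) ∎
      where
      j≤N : j ≤ N
      j≤N = ℕ.≤-trans j≤m (ℕ.≤-trans (ℕ.m≤m+n m m) (ℕ.n≤1+n _))
      A = choose (suc (N ∸ j)) (suc j)
      B = choose (N ∸ j) j
      n≡ : suc (N ∸ j) ℕ.+ suc j ≡ n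
      n≡ = ≡.trans (ℕ.+-suc (suc (N ∸ j)) j) (≡.cong (λ z → suc (suc z)) (ℕ.m∸n+n≡m j≤N))

module DicksonClosedForm {c ℓ : Level} {q : ℕ} (F : FiniteField c ℓ q)
                         {p e : ℕ} (q≡pᵉ : q ≡ p ℕ.^ e) (p-prime : Prime p) (2<p : 2 ℕ.< p) where

  open FieldProperties F
  open Counting F using (p×1≈0; ×1≉0)
  open DicksonSums F using (fibonacci; fibonacci-rec; dickson≈fibonacci)
  open Frobenius commRing using ([k×1]^p^n≈k×1)
  open import Data.Nat as ℕ using (zero; suc; _<_; z≤n; s≤s)
  import Data.Nat.Properties as ℕ
  open import Data.Integer using (+_)
  open import Data.Product using (_,_; proj₁; proj₂)
  open import Relation.Nullary using (¬_)
  open import Relation.Binary.PropositionalEquality as ≡ using (_≡_)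

  -- The discriminant of X² - X - y.
  disc : Carrier → Carrier
  disc y = 1# + 4 × 1# * y

  characteristic : p × 1# ≈ 0#
  characteristic = p×1≈0 {p} {e} q≡pᵉ

  2≉0 : ¬ (2 × 1# ≈ 0#)
  2≉0 = ×1≉0 p-prime characteristic (s≤s z≤n) 2<p

  half : Carrier
  half = proj₁ (inverse (2 × 1#) 2≉0)

  2*half≈1 : 2 × 1# * half ≈ 1#
  2*half≈1 = proj₂ (inverse (2 × 1#) 2≉0)

  half^p^l≈half : ∀ l → half ^ (p ℕ.^ l) ≈ half
  half^p^l≈half l = *-cancelˡ 2≉0 (begin
    2 × 1# * half ^ N                  ≈⟨ *-congʳ ([k×1]^p^n≈k×1 p-prime characteristic l 2) ⟨
    (2 × 1#) ^ N * half ^ N            ≈⟨ ^-distrib-* (2 × 1#) half N ⟨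
    (2 × 1# * half) ^ N                ≈⟨ ^-congˡ N 2*half≈1 ⟩
    1# ^ N                             ≈⟨ 1^n≈1 N ⟩
    1#                                 ≈⟨ 2*half≈1 ⟨
    2 × 1# * half                      ∎)
    where N = p ℕ.^ l

  module _ (y : Carrier) where

    open QuadraticExtension commRing (disc y) using (Carrier′; _≈′_; _+′_; _*′_; 1′; quadraticRing)
    private module R′ = CommutativeRing quadraticRing
    open import Algebra.Properties.Semiring.Exp R′.semiring using ()
      renaming (_^_ to _^′_; ^-congˡ to ^′-congˡ)
    open import Algebra.Properties.Semiring.Mult R′.semiring using () renaming (_×_ to _×′_)
    open Frobenius quadraticRing using () renaming (frobenius-^ to frobenius′-^)

    w : Carrier
    w = disc y

    half*2≈1 : half * 2 × 1# ≈ 1#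
    half*2≈1 = trans (*-comm half _) 2*half≈1

    -- α = (1 + √w) / 2 is a root of X² - X - y.
    α : Carrier′
    α = half , half

    α²≈α+y : α *′ α ≈′ α +′ (y , 0#)
    α²≈α+y = first , trans second (sym (+-identityʳ half))
      where
      first : half * half + w * (half * half) ≈ half + y
      first = begin
        half * half + (1# + 4 × 1# * y) * (half * half)
          ≈⟨ +-congˡ (*-congʳ (+-congʳ (+-identityʳ 1#))) ⟨
        half * half + (1 × 1# + 4 × 1# * y) * (half * half)
          ≈⟨ solve 2 (λ h y → h :* h :+ (con (+ 1) :+ con (+ 4) :* y) :* (h :* h)
                           := (h :* con (+ 2)) :* h :+ ((h :* con (+ 2)) :* (h :* con (+ 2))) :* y)
                     refl half y ⟩
        (half * 2 × 1#) * half + ((half * 2 × 1#) * (half * 2 × 1#)) * y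
          ≈⟨ +-cong (*-congʳ half*2≈1) (*-congʳ (*-cong half*2≈1 half*2≈1)) ⟩
        1# * half + (1# * 1#) * y
          ≈⟨ +-cong (*-identityˡ half) (trans (*-congʳ (*-identityˡ 1#)) (*-identityˡ y)) ⟩
        half + y ∎
      second : half * half + half * half ≈ half
      second = begin
        half * half + half * half   ≈⟨ solve 1 (λ h → h :* h :+ h :* h := (h :* con (+ 2)) :* h) refl half ⟩
        (half * 2 × 1#) * half      ≈⟨ *-congʳ half*2≈1 ⟩
        1# * half                   ≈⟨ *-identityˡ half ⟩
        half                        ∎

    irrational : ℕ → Carrier
    irrational j = proj₂ (α ^′ j)

    irrational-rec : ∀ j → irrational (suc (suc j)) ≈ irrational (suc j) + y * irrational j
    irrational-rec j = begin
      proj₂ (α *′ (α *′ α ^′ j))                 ≈⟨ proj₂ (R′.sym (R′.*-assoc α α (α ^′ j))) ⟩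
      proj₂ ((α *′ α) *′ α ^′ j)                 ≈⟨ proj₂ (R′.*-congʳ {α ^′ j} α²≈α+y) ⟩
      proj₂ ((α +′ (y , 0#)) *′ α ^′ j)          ≈⟨ proj₂ (R′.distribʳ (α ^′ j) α (y , 0#)) ⟩
      irrational (suc j) + (y * irrational j + 0# * proj₁ (α ^′ j))
        ≈⟨ +-congˡ (trans (+-congˡ (zeroˡ _)) (+-identityʳ _)) ⟩
      irrational (suc j) + y * irrational j      ∎

    -- Binet's formula: fibonacci N y = (α^(N+1) - ᾱ^(N+1)) / √w.
    fibonacci≈2*irrational : ∀ N → fibonacci N y ≈ 2 × 1# * irrational (suc N)
    fibonacci≈2*irrational zero = begin
      (1# + 0#) * 1#                   ≈⟨ trans (*-identityʳ _) (+-identityʳ 1#) ⟩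
      1#                               ≈⟨ 2*half≈1 ⟨
      2 × 1# * half
        ≈⟨ *-congˡ (trans (+-congʳ (zeroʳ half)) (trans (+-identityˡ _) (*-identityʳ half))) ⟨
      2 × 1# * (half * 0# + half * 1#) ∎
    fibonacci≈2*irrational (suc zero) = begin
      (1# + 0#) * 1# + 0# * (y * 1#)
        ≈⟨ trans (+-cong (*-identityʳ _) (zeroˡ _)) (trans (+-identityʳ _) (+-identityʳ 1#)) ⟩
      1#                               ≈⟨ 2*half≈1 ⟨
      2 × 1# * half                    ≈⟨ *-congˡ (trans (proj₂ (R′.*-congˡ {α} (R′.*-identityʳ α)))
                                                         (trans (proj₂ α²≈α+y) (+-identityʳ half))) ⟨
      2 × 1# * irrational 2            ∎
    fibonacci≈2*irrational (suc (suc N)) = begin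
      fibonacci (suc (suc N)) y                      ≈⟨ fibonacci-rec N y ⟩
      fibonacci (suc N) y + y * fibonacci N y        ≈⟨ +-cong (fibonacci≈2*irrational (suc N))
                                                               (*-congˡ (fibonacci≈2*irrational N)) ⟩
      t * irrational (suc (suc N)) + y * (t * irrational (suc N))
        ≈⟨ solve 4 (λ t a y b → t :* a :+ y :* (t :* b) := t :* (a :+ y :* b)) refl t _ y _ ⟩
      t * (irrational (suc (suc N)) + y * irrational (suc N))
        ≈⟨ *-congˡ (irrational-rec (suc N)) ⟨
      t * irrational (suc (suc (suc N)))             ∎
      where t = 2 × 1#

    ×′1′≈[×1,0] : ∀ n → n ×′ 1′ ≈′ (n × 1# , 0#)
    ×′1′≈[×1,0] zero    = refl , refl
    ×′1′≈[×1,0] (suc n) = +-congˡ (proj₁ (×′1′≈[×1,0] n))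
                        , trans (+-congˡ (proj₂ (×′1′≈[×1,0] n))) (+-identityʳ 0#)

    [a,0]^t : ∀ a t → (a , 0#) ^′ t ≈′ (a ^ t , 0#)
    [a,0]^t a zero    = refl , refl
    [a,0]^t a (suc t) = R′.trans (R′.*-congˡ {a , 0#} ([a,0]^t a t))
      ( trans (+-congˡ (trans (*-congˡ (zeroˡ 0#)) (zeroʳ w))) (+-identityʳ _)
      , trans (+-cong (zeroʳ a) (zeroˡ _)) (+-identityʳ 0#))

    [0,b]^odd : ∀ b j → (0# , b) ^′ suc (j ℕ.+ j) ≈′ (0# , b ^ suc (j ℕ.+ j) * w ^ j)
    [0,b]^odd b zero    = trans (+-cong (zeroˡ 1#) (trans (*-congˡ (zeroʳ b)) (zeroʳ w))) (+-identityʳ 0#)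
                        , trans (+-congʳ (zeroʳ 0#)) (trans (+-identityˡ _) (sym (*-identityʳ _)))
    [0,b]^odd b (suc j) =
      ≡.subst (λ t → (0# , b) ^′ suc t ≈′ (0# , b ^ suc t * w ^ suc j)) (≡.sym (ℕ.+-suc (suc j) j))
        (R′.trans (R′.*-congˡ {0# , b} (R′.*-congˡ {0# , b} ([0,b]^odd b j)))
          ( solve 4 (λ b X Y w → con (+ 0) :* (con (+ 0) :* con (+ 0) :+ w :* (b :* (X :* Y)))
                               :+ w :* (b :* (con (+ 0) :* (X :* Y) :+ b :* con (+ 0))) := con (+ 0))
                    refl b X Y w
          , solve 4 (λ b X Y w → con (+ 0) :* (con (+ 0) :* (X :* Y) :+ b :* con (+ 0))
                               :+ b :* (con (+ 0) :* con (+ 0) :+ w :* (b :* (X :* Y)))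
                               := (b :* (b :* X)) :* (w :* Y))
                    refl b X Y w))
      where
      X = b ^ suc (j ℕ.+ j)
      Y = w ^ j

    -- Split α = half + half √w and apply the Frobenius map of the quadratic extension.
    α^p^l : ∀ l m → p ℕ.^ l ≡ suc (m ℕ.+ m) → α ^′ (p ℕ.^ l) ≈′ (half , half * w ^ m)
    α^p^l l m p^l≡1+2m =
      R′.trans (^′-congˡ N (sym (+-identityʳ half) , sym (+-identityˡ half)))
        (R′.trans (frobenius′-^ p-prime char′ l (half , 0#) (0# , half))
          (R′.trans (R′.+-cong ([a,0]^t half N) halfᴺ√w)
            ( trans (+-identityʳ _) (half^p^l≈half l)
            , trans (+-identityˡ _) (*-congʳ (half^p^l≈half l)))))
      where
      N = p ℕ.^ l
      char′ : p ×′ 1′ ≈′ (0# , 0#)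
      char′ = trans (proj₁ (×′1′≈[×1,0] p)) characteristic , proj₂ (×′1′≈[×1,0] p)
      halfᴺ√w : (0# , half) ^′ N ≈′ (0# , half ^ N * w ^ m)
      halfᴺ√w = ≡.subst (λ t → (0# , half) ^′ t ≈′ (0# , half ^ t * w ^ m)) (≡.sym p^l≡1+2m) ([0,b]^odd half m)

    module _ {l m : ℕ} (p^l≡3+2m : p ℕ.^ l ≡ 3 ℕ.+ (m ℕ.+ m)) where

      private
        W : Carrier
        W = w ^ suc m

        α^[3+2m] : α ^′ (3 ℕ.+ (m ℕ.+ m)) ≈′ (half , half * W)
        α^[3+2m] = ≡.subst (λ t → α ^′ t ≈′ (half , half * W)) p^l≡3+2m
          (α^p^l l (suc m) (≡.trans p^l≡3+2m (≡.cong (λ z → suc (suc z)) (≡.sym (ℕ.+-suc m m)))))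

      fibonacci[3+2m] : fibonacci (3 ℕ.+ (m ℕ.+ m)) y ≈ half * W + half
      fibonacci[3+2m] = begin
        fibonacci (3 ℕ.+ (m ℕ.+ m)) y          ≈⟨ fibonacci≈2*irrational (3 ℕ.+ (m ℕ.+ m)) ⟩
        2 × 1# * irrational (suc (3 ℕ.+ (m ℕ.+ m)))
          ≈⟨ *-congˡ (proj₂ (R′.*-congˡ {α} α^[3+2m])) ⟩
        2 × 1# * (half * (half * W) + half * half)
          ≈⟨ solve 3 (λ t h W → t :* (h :* (h :* W) :+ h :* h) := (t :* h) :* (h :* W :+ h)) refl _ half W ⟩
        (2 × 1# * half) * (half * W + half)              ≈⟨ *-congʳ 2*half≈1 ⟩
        1# * (half * W + half)                           ≈⟨ *-identityˡ _ ⟩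
        half * W + half                                  ∎

      fibonacci[2+2m] : fibonacci (2 ℕ.+ (m ℕ.+ m)) y ≈ W
      fibonacci[2+2m] = begin
        fibonacci (2 ℕ.+ (m ℕ.+ m)) y    ≈⟨ fibonacci≈2*irrational (2 ℕ.+ (m ℕ.+ m)) ⟩
        2 × 1# * irrational (3 ℕ.+ (m ℕ.+ m))
                                             ≈⟨ *-congˡ (proj₂ α^[3+2m]) ⟩
        2 × 1# * (half * W)                  ≈⟨ *-assoc _ _ _ ⟨
        (2 × 1# * half) * W                  ≈⟨ *-congʳ 2*half≈1 ⟩
        1# * W                               ≈⟨ *-identityˡ W ⟩
        W                                    ∎

  dickson-closed : ∀ {l m} → p ℕ.^ l ≡ 3 ℕ.+ (m ℕ.+ m) → ∀ k x →
                   D F (p ℕ.^ l) k x ≈ 1# + k × 1# * half * (disc (- x) ^ suc m - 1#)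
  dickson-closed {l} {m} p^l≡3+2m k x = begin
    D F (p ℕ.^ l) k x
      ≡⟨ ≡.cong (λ n → D F n k x) p^l≡3+2m ⟩
    D F (suc (suc N)) k x
      ≈⟨ dickson≈fibonacci m k x ⟩
    fibonacci (suc (suc N)) y + (1# - K) * (y * fibonacci N y)
      ≈⟨ +-cong (fibonacci[3+2m] y {l} {m} p^l≡3+2m) (*-cong (+-congʳ (sym (+-identityʳ 1#))) y*fibonacci) ⟩
    (half * W + half) + (1 × 1# - K) * ((half * W + half) - W)
      ≈⟨ solve 3 (λ h W K → (h :* W :+ h) :+ (con (+ 1) :- K) :* ((h :* W :+ h) :- W)
                       := (con (+ 1) :+ K :* h :* (W :- con (+ 1)))
                          :+ (con (+ 2) :* h :- con (+ 1)) :* (W :+ con (+ 1) :- K :* W))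
               refl half W K ⟩
    (1 × 1# + K * half * (W - 1 × 1#)) + (2 × 1# * half - 1 × 1#) * (W + 1 × 1# - K * W)
      ≈⟨ +-cong (+-cong (+-identityʳ 1#) (*-congˡ (+-congˡ (-‿cong (+-identityʳ 1#)))))
                (trans (*-congʳ (trans (+-cong 2*half≈1 (-‿cong (+-identityʳ 1#))) (-‿inverseʳ 1#))) (zeroˡ _)) ⟩
    (1# + K * half * (W - 1#)) + 0#
      ≈⟨ +-identityʳ _ ⟩
    1# + K * half * (W - 1#) ∎
    where
    N = suc (m ℕ.+ m)
    y = - x
    K = k × 1#
    W = disc y ^ suc m
    y*fibonacci : y * fibonacci N y ≈ (half * W + half) - W
    y*fibonacci = begin
      y * fibonacci N y
        ≈⟨ solve 2 (λ a b → b := (a :+ b) :- a) refl (fibonacci (suc N) y) _ ⟩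
      (fibonacci (suc N) y + y * fibonacci N y) - fibonacci (suc N) y
        ≈⟨ +-cong (sym (fibonacci-rec N y)) (-‿cong (fibonacci[2+2m] y {l} {m} p^l≡3+2m)) ⟩
      fibonacci (suc (suc N)) y - W
        ≈⟨ +-congʳ (fibonacci[3+2m] y {l} {m} p^l≡3+2m) ⟩
      (half * W + half) - W ∎

  4^[1+m]≈1 : ∀ {l m} → p ℕ.^ l ≡ 3 ℕ.+ (m ℕ.+ m) → (4 × 1#) ^ suc m ≈ 1#
  4^[1+m]≈1 {l} {m} p^l≡3+2m = *-cancelˡ 2≉0 (begin
    2 × 1# * (4 × 1#) ^ suc m                        ≈⟨ *-congˡ (^-congˡ (suc m) (×1-homo-* 2 2)) ⟩
    2 × 1# * (2 × 1# * 2 × 1#) ^ suc m               ≈⟨ *-congˡ (^-distrib-* _ _ (suc m)) ⟩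
    2 × 1# * ((2 × 1#) ^ suc m * (2 × 1#) ^ suc m)   ≈⟨ *-congˡ (^-homo-* _ (suc m) (suc m)) ⟨
    (2 × 1#) ^ suc (suc m ℕ.+ suc m)                 ≡⟨ ≡.cong ((2 × 1#) ^_) p^l≡1+2[1+m] ⟨
    (2 × 1#) ^ (p ℕ.^ l)                             ≈⟨ [k×1]^p^n≈k×1 p-prime characteristic l 2 ⟩
    2 × 1#                                           ≈⟨ *-identityʳ _ ⟨
    2 × 1# * 1#                                      ∎)
    where
    p^l≡1+2[1+m] : p ℕ.^ l ≡ suc (suc m ℕ.+ suc m)
    p^l≡1+2[1+m] = ≡.trans p^l≡3+2m (≡.cong (λ z → suc (suc z)) (≡.sym (ℕ.+-suc m m)))

module DicksonPermutation {c ℓ : Level} {q : ℕ} (F : FiniteField c ℓ q)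
                          {p e : ℕ} (q≡pᵉ : q ≡ p ℕ.^ e) (p-prime : Prime p) (2<p : 2 ℕ.< p)
                          {l m : ℕ} (p^l≡3+2m : p ℕ.^ l ≡ 3 ℕ.+ (m ℕ.+ m)) (k : ℕ) where

  open FieldProperties F
  open Counting F using (injective⇒surjective)
  open DicksonClosedForm F {p} {e} q≡pᵉ p-prime 2<p using (disc; half; 2≉0; 2*half≈1; dickson-closed)
  open import Algebra.Properties.Ring ring using (-‿injective)
  open import Data.Nat using (suc)
  open import Data.Integer using (+_)
  open import Data.Product as Product using (_,_)
  open import Function.Bundles using (_⇔_; mk⇔)
  open import Function.Definitions using (Injective; Congruent)
  open import Relation.Nullary using (¬_)

  private
    n : ℕ
    n = p ℕ.^ l
    K : Carrier
    K = k × 1#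
    W : Carrier → Carrier
    W x = disc (- x) ^ suc m

    closed : ∀ x → D F n k x ≈ 1# + K * half * (W x - 1#)
    closed = dickson-closed {l} {m} p^l≡3+2m k

    W-cong : Congruent _≈_ _≈_ W
    W-cong x≈y = ^-congˡ (suc m) (+-congˡ (*-congˡ (-‿cong x≈y)))

    D-cong : Congruent _≈_ _≈_ (D F n k)
    D-cong {x} {y} x≈y = trans (closed x) (trans (+-congˡ (*-congˡ (+-congʳ (W-cong x≈y)))) (sym (closed y)))

    half≉0 : ¬ (half ≈ 0#)
    half≉0 half≈0 = 1≉0 (trans (sym 2*half≈1) (trans (*-congˡ half≈0) (zeroʳ _)))

    4≉0 : ¬ (4 × 1# ≈ 0#)
    4≉0 4≈0 = x≉0∧y≉0⇒x*y≉0 2≉0 2≉0 (trans (sym (×1-homo-* 2 2)) 4≈0)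

    disc-injective : Injective _≈_ _≈_ disc
    disc-injective disc-u≈disc-v = *-cancelˡ 4≉0 (+-cancelˡ 1# _ _ disc-u≈disc-v)

    preimage : Carrier → Carrier
    preimage a = - ((a - 1#) * (half * half))

    disc-preimage : ∀ a → disc (- preimage a) ≈ a
    disc-preimage a = begin
      1# + 4 × 1# * - - ((a - 1#) * (half * half))
        ≈⟨ +-congˡ (*-congˡ (-‿involutive _)) ⟩
      1# + 4 × 1# * ((a - 1#) * (half * half))
        ≈⟨ +-congˡ (solve 2 (λ b h → con (+ 4) :* (b :* (h :* h)) := b :* ((con (+ 2) :* h) :* (con (+ 2) :* h)))
                            refl (a - 1#) half) ⟩
      1# + (a - 1#) * ((2 × 1# * half) * (2 × 1# * half))
        ≈⟨ +-congˡ (*-congˡ (trans (*-cong 2*half≈1 2*half≈1) (*-identityˡ 1#))) ⟩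
      1# + (a - 1#) * 1#
        ≈⟨ +-congˡ (*-identityʳ _) ⟩
      1# + (a - 1#)
        ≈⟨ solve 2 (λ o a → o :+ (a :- o) := a) refl 1# a ⟩
      a ∎

    constant : K ≈ 0# → ∀ x → D F n k x ≈ 1#
    constant K≈0 x = trans (closed x)
      (trans (+-congˡ (trans (*-congʳ (trans (*-congʳ K≈0) (zeroˡ half))) (zeroˡ _))) (+-identityʳ 1#))

    injective⇒K≉0 : Injective _≈_ _≈_ (D F n k) → ¬ (K ≈ 0#)
    injective⇒K≉0 D-injective K≈0 = 1≉0 (sym (D-injective (trans (constant K≈0 0#) (sym (constant K≈0 1#)))))

    injective⇒^-injective : Injective _≈_ _≈_ (D F n k) → Injective _≈_ _≈_ (_^ suc m)
    injective⇒^-injective D-injective {a} {b} aᵐ⁺¹≈bᵐ⁺¹ = begin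
      a                    ≈⟨ disc-preimage a ⟨
      disc (- preimage a)  ≈⟨ +-congˡ (*-congˡ (-‿cong (D-injective D[pa]≈D[pb]))) ⟩
      disc (- preimage b)  ≈⟨ disc-preimage b ⟩
      b                    ∎
      where
      W[pa]≈W[pb] : W (preimage a) ≈ W (preimage b)
      W[pa]≈W[pb] = trans (^-congˡ (suc m) (disc-preimage a))
                          (trans aᵐ⁺¹≈bᵐ⁺¹ (sym (^-congˡ (suc m) (disc-preimage b))))
      D[pa]≈D[pb] : D F n k (preimage a) ≈ D F n k (preimage b)
      D[pa]≈D[pb] = trans (closed (preimage a))
                          (trans (+-congˡ (*-congˡ (+-congʳ W[pa]≈W[pb]))) (sym (closed (preimage b))))

    injective : ¬ (K ≈ 0#) → Injective _≈_ _≈_ (_^ suc m) → Injective _≈_ _≈_ (D F n k)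
    injective K≉0 ^-injective {x} {y} Dx≈Dy =
      -‿injective (disc-injective (^-injective (+-cancelʳ (- 1#) _ _ Wx-1≈Wy-1)))
      where
      Wx-1≈Wy-1 : W x - 1# ≈ W y - 1#
      Wx-1≈Wy-1 = *-cancelˡ (x≉0∧y≉0⇒x*y≉0 K≉0 half≉0)
                    (+-cancelˡ 1# _ _ (trans (sym (closed x)) (trans Dx≈Dy (closed y))))

  -- Through the closed form 1 + k/2 · ((1 - 4x)^(m+1) - 1).
  dickson-permutation⇔ : IsPermutation F (D F n k) ⇔ (¬ (K ≈ 0#) Product.× Injective _≈_ _≈_ (_^ suc m))
  dickson-permutation⇔ = mk⇔
    (λ (D-injective , _) → injective⇒K≉0 D-injective , injective⇒^-injective D-injective)
    (λ (K≉0 , ^-injective) → injective K≉0 ^-injective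
                           , injective⇒surjective (D F n k) D-cong (injective K≉0 ^-injective))

open import Data.Nat using (ℕ; _≤_; _<_; _∸_; _^_; _/_)
open import Data.Nat.GCD using (gcd)
open import Data.Nat.Primality using (Prime)
open import Data.Product using (_×_)
open import Relation.Nullary using (¬_)
open import Relation.Binary.PropositionalEquality using (_≡_; _≢_)
open import Function.Bundles using (_⇔_)

open import Data.Nat using (suc; z≤n; s≤s)
open import Data.Nat.Properties using (+-suc; <⇒≤)
open import Data.Nat.Primality using (prime?)
open import Data.Product using (_,_; proj₂)
open import Data.Product.Function.NonDependent.Propositional using (_×-⇔_)
open import Function.Bundles using (module Equivalence)
open import Function.Definitions using (Injective)
open import Function.Properties.Equivalence using () renaming (trans to ⇔-trans)
open import Relation.Nullary.Decidable using (from-yes)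
import Relation.Binary.PropositionalEquality as ≡

3-prime : Prime 3
3-prime = from-yes (prime? 3)

dickson-3^l-permutation⇔ : ∀ {c ℓ} k l e → k ≤ 2 → 0 < l → (F : FiniteField c ℓ (3 ^ e)) →
                           IsPermutation F (D F (3 ^ l) k) ⇔ (k ≢ 0 × gcd ((3 ^ l ∸ 1) / 2) (3 ^ e ∸ 1) ≡ 1)
dickson-3^l-permutation⇔ k l e k≤2 0<l F with Arithmetic.odd-prime^n 3-prime (s≤s (s≤s (s≤s z≤n))) 0<l
... | m , 3^l≡3+2m =
  ⇔-trans criterion (Counting.k×1≉0⇔k≢0 F 3-prime characteristic (s≤s k≤2) ×-⇔ power-criterion)
  where
  open FieldProperties F using (_≈_; 0#; 1#) renaming (_×_ to _·_; _^_ to _^ᶠ_)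
  open DicksonClosedForm F {3} {e} ≡.refl 3-prime (s≤s (s≤s (s≤s z≤n))) using (characteristic)

  criterion : IsPermutation F (D F (3 ^ l) k) ⇔ (¬ (k · 1# ≈ 0#) × Injective _≈_ _≈_ (_^ᶠ suc m))
  criterion = DicksonPermutation.dickson-permutation⇔ F {3} {e} ≡.refl 3-prime (s≤s (s≤s (s≤s z≤n)))
                {l} {m} 3^l≡3+2m k

  [3^l∸1]/2≡1+m : (3 ^ l ∸ 1) / 2 ≡ suc m
  [3^l∸1]/2≡1+m = begin
    (3 ^ l ∸ 1) / 2          ≡⟨ ≡.cong (λ n → (n ∸ 1) / 2) 3^l≡3+2m ⟩
    (2 ℕ.+ (m ℕ.+ m)) / 2    ≡⟨ ≡.cong (λ n → suc n / 2) (+-suc m m) ⟨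
    (suc m ℕ.+ suc m) / 2    ≡⟨ Arithmetic.[m+m]/2≡m (suc m) ⟩
    suc m                    ∎
    where open ≡.≡-Reasoning

  power-criterion : Injective _≈_ _≈_ (_^ᶠ suc m) ⇔ gcd ((3 ^ l ∸ 1) / 2) (3 ^ e ∸ 1) ≡ 1
  power-criterion rewrite [3^l∸1]/2≡1+m = PowerMap.^-injective⇔gcd≡1 F (s≤s z≤n)

-- x ↦ x^(m+1) is not injective: 4^(m+1) = 1 = 1^(m+1) although 4 - 1 = 3 ≠ 0.
dickson-p^l-not-permutation : ∀ {c ℓ} p k l e → Prime p → 3 < p → 0 < l → (F : FiniteField c ℓ (p ^ e)) →
                              ¬ IsPermutation F (D F (p ^ l) k)
dickson-p^l-not-permutation p k l e p-prime 3<p 0<l F perm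
  with Arithmetic.odd-prime^n p-prime (<⇒≤ 3<p) 0<l
... | m , p^l≡3+2m = Counting.×1≉0 F p-prime characteristic (s≤s z≤n) 3<p
      (+-cancelˡ 1# _ _ (trans 4≈1 (sym (+-identityʳ 1#))))
  where
  2<p : 2 < p
  2<p = <⇒≤ 3<p
  open FieldProperties F renaming (_×_ to _·_; _^_ to _^ᶠ_)
  open DicksonClosedForm F {p} {e} ≡.refl p-prime 2<p using (characteristic; 4^[1+m]≈1)

  criterion : IsPermutation F (D F (p ^ l) k) ⇔ (¬ (k · 1# ≈ 0#) × Injective _≈_ _≈_ (_^ᶠ suc m))
  criterion = DicksonPermutation.dickson-permutation⇔ F {p} {e} ≡.refl p-prime 2<p {l} {m} p^l≡3+2m k

  4≈1 : 4 · 1# ≈ 1#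
  4≈1 = proj₂ (Equivalence.to criterion perm) (trans (4^[1+m]≈1 {l} {m} p^l≡3+2m) (sym (1^n≈1 (suc m))))

theorem2p8 : ∀ {c ℓ : Level} →
    (∀ (k l e : ℕ) → k ≤ 2 → 0 < l → l ≤ e →
      (F : FiniteField c ℓ (3 ^ e)) →
      IsPermutation F (D F (3 ^ l) k)
        ⇔ (k ≢ 0 × gcd ((3 ^ l ∸ 1) / 2) (3 ^ e ∸ 1) ≡ 1))
    × (∀ (p k l e : ℕ) → Prime p → 3 < p → k ≤ p ∸ 1 → 0 < l → l ≤ e →
      (F : FiniteField c ℓ (p ^ e)) →
      ¬ IsPermutation F (D F (p ^ l) k))
theorem2p8 =
    (λ k l e k≤2 0<l _ → dickson-3^l-permutation⇔ k l e k≤2 0<l)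
  , (λ p k l e p-prime 3<p _ 0<l _ → dickson-p^l-not-permutation p k l e p-prime 3<p 0<l)
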